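{- Let $d\geq 1$ be an integer and let $\theta_d\in[1,2]$ be the unique solution of $x^d=\sum_{i=0}^{d-1}x^i$. If $K\in\mathcal{F}(n,d)$ or $K\in\mathcal{M}(n,d)$, then $\mathrm{b}(K)\leq(\theta_d)^n$.
   Context: $\mathcal{F}(n,d)$ is the family of simplicial complexes $K$ with $n$ vertices such that every minimal non-face of $K$ (a subset of the vertex set that is not a face but all of whose proper subsets are faces) has cardinality at most $d$. $\mathcal{M}(n,d)$ is the family of simplicial complexes $K$ with $n$ vertices such that every maximal face $F$ of $K$ satisfies $|F|\geq n-d$. Fix a field $\mathbf{k}$; $\mathrm{b}(K)=\sum_i\dim_{\mathbf{k}}\widetilde{H}_i(K;\mathbf{k})$ is the total reduced Betti number, with $\mathrm{b}(\emptyset)=1$ for the empty complex. -}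

module Defs where

open import Level using (Level; _⊔_) renaming (suc to lsuc; zero to lzero)
open import Data.Nat as ℕ using (ℕ; zero; suc; _∸_)
open import Data.Fin using (Fin; zero; suc; toℕ)
open import Data.Vec using (Vec; []; _∷_; lookup; _[_]≔_)
open import Data.List using (List; []; _∷_; map; _++_; foldr)
open import Data.Fin.Subset using (Subset; Side; inside; outside; ⁅_⁆; _⊆_; _⊂_; ∣_∣; ⊥)
open import Data.Product using (Σ; _×_; ∃)
open import Data.Integer using (+_)
open import Data.Rational as ℚ using (ℚ; 0ℚ; 1ℚ)
open import Relation.Nullary using (¬_)
open import Relation.Binary.PropositionalEquality using (_≡_)
open import Algebra.Bundles using (CommutativeRing)

record Field (c ℓ : Level) : Set (lsuc (c ⊔ ℓ)) where
  field
    cring : CommutativeRing c ℓ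
  open CommutativeRing cring public
  field
    0≉1     : ¬ (0# ≈ 1#)
    inverse : ∀ x → ¬ (x ≈ 0#) → Σ Carrier (λ y → (x * y) ≈ 1#)

-- Simplicial complexes on the vertex set Fin n (faces = subsets of Fin n).
-- "K has n vertices": every singleton is a face; the empty set is a face.

record SimplicialComplex (n : ℕ) : Set₁ where
  field
    IsFace     : Subset n → Set
    empty-face : IsFace ⊥
    vertex     : ∀ v → IsFace ⁅ v ⁆
    down-closed : ∀ σ τ → τ ⊆ σ → IsFace σ → IsFace τ

open SimplicialComplex public

IsMinimalNonFace : ∀ {n} → SimplicialComplex n → Subset n → Set
IsMinimalNonFace K σ = ¬ IsFace K σ × (∀ τ → τ ⊂ σ → IsFace K τ)

IsMaximalFace : ∀ {n} → SimplicialComplex n → Subset n → Set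
IsMaximalFace K σ = IsFace K σ × (∀ τ → σ ⊂ τ → ¬ IsFace K τ)

InF : ∀ {n} → SimplicialComplex n → ℕ → Set
InF K d = ∀ σ → IsMinimalNonFace K σ → ∣ σ ∣ ℕ.≤ d

-- K ∈ 𝓜(n,d)   (|F| ≥ n - d; for d ≥ n the condition is vacuous)
InM : ∀ {n} → SimplicialComplex n → ℕ → Set
InM {n} K d = ∀ σ → IsMaximalFace K σ → n ∸ d ℕ.≤ ∣ σ ∣

countBefore : ∀ {n} → Subset n → Fin n → ℕ
countBefore (x ∷ σ) zero = 0
countBefore (inside ∷ σ) (suc v) = suc (countBefore σ v)
countBefore (outside ∷ σ) (suc v) = countBefore σ v

allFinL : ∀ n → List (Fin n)
allFinL zero = []
allFinL (suc n) = zero ∷ map suc (allFinL n)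

module Homology {c ℓ : Level} (F : Field c ℓ) where
  open Field F

  sumL : ∀ {A : Set} → (A → Carrier) → List A → Carrier
  sumL f = foldr (λ a r → f a + r) 0#

  sumFin : ∀ {m} → (Fin m → Carrier) → Carrier
  sumFin {m} f = sumL f (allFinL m)

  signPow : ℕ → Carrier
  signPow zero = 1#
  signPow (suc k) = - signPow k

  Vect : ℕ → Set c
  Vect n = Subset n → Carrier

  ∂ : ∀ {n} → Vect n → Vect n
  ∂ {n} f τ = sumL term (allFinL n)
    where
    term : Fin n → Carrier
    term v with lookup τ v
    ... | inside  = 0#
    ... | outside = signPow (countBefore τ v) * f (τ [ v ]≔ inside)

  Independent : ∀ {n m} → (Fin m → Vect n) → Set (c ⊔ ℓ)
  Independent {n} {m} vs =
    (cs : Fin m → Carrier) →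
    (∀ σ → sumFin (λ j → cs j * vs j σ) ≈ 0#) → ∀ j → cs j ≈ 0#

  IsDim : ∀ {n p} → (Vect n → Set p) → ℕ → Set (c ⊔ ℓ ⊔ p)
  IsDim {n} P m =
    Σ (Fin m → Vect n) (λ vs → (∀ j → P (vs j)) × Independent vs)
    × (∀ k (ws : Fin k → Vect n) → (∀ j → P (ws j)) → Independent ws → k ℕ.≤ m)

  module _ {n : ℕ} (K : SimplicialComplex n) where
    -- C_s : chains supported on faces with s elements (dimension s - 1)
    Chain : ℕ → Vect n → Set ℓ
    Chain s f = ∀ σ → ¬ (IsFace K σ × ∣ σ ∣ ≡ s) → f σ ≈ 0#

    Cycle : ℕ → Vect n → Set ℓ
    Cycle s f = Chain s f × (∀ τ → ∂ f τ ≈ 0#)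

    Boundary : ℕ → Vect n → Set (c ⊔ ℓ)
    Boundary s g = Chain s g × Σ (Vect n) (λ f → Chain (suc s) f × (∀ τ → ∂ f τ ≈ g τ))

    -- h = dim H̃_{s-1}(K; F) = dim Z_s - dim B_s
    HomDim : ℕ → ℕ → Set (c ⊔ ℓ)
    HomDim s h = Σ ℕ (λ a → Σ ℕ (λ b → IsDim (Cycle s) a × IsDim (Boundary s) b × h ≡ a ∸ b))

    sumℕ : ∀ {m} → (Fin m → ℕ) → ℕ
    sumℕ {m} h = foldr (λ j r → h j ℕ.+ r) 0 (allFinL m)

    -- b(K) = Σ_{i = -1}^{n-1} dim H̃_i(K; F)   (faces have at most n elements)
    TotalBetti : ℕ → Set (c ⊔ ℓ)
    TotalBetti b = Σ (Fin (suc n) → ℕ) (λ hs → (∀ s → HomDim (toℕ s) (hs s)) × b ≡ sumℕ hs)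

-- θ_d without reals: q > θ_d  iff  q > 0 and q^d > Σ_{i<d} q^i.

powℚ : ℚ → ℕ → ℚ
powℚ q zero = 1ℚ
powℚ q (suc k) = q ℚ.* powℚ q k

geomℚ : ℚ → ℕ → ℚ
geomℚ q zero = 0ℚ
geomℚ q (suc k) = powℚ q k ℚ.+ geomℚ q k

ℕtoℚ : ℕ → ℚ
ℕtoℚ b = (+ b) ℚ./ 1

-- b ≤ (θ_d)^n, expressed as: b ≤ q^n for every rational q > θ_d
-- (equivalent since θ_d^n = inf { q^n : q ∈ ℚ, q > θ_d }).
BelowThetaPow : ℕ → ℕ → ℕ → Set
BelowThetaPow d n b = ∀ q → 0ℚ ℚ.< q → geomℚ q d ℚ.< powℚ q d → ℕtoℚ b ℚ.≤ powℚ q n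

-- A Morse cover of a complex lists critical faces and pairs (σ, σ ∖ v) that together cover all faces,
-- ordered so that the boundaries of the tops are triangular against the bottoms. Then b(K) ≤ #critical:
-- in each dimension the cycles together with the tops are independent chains supported on the critical
-- faces, the tops and the bottoms (Steinitz), while the boundaries of the tops are independent boundaries.
-- As K = del_v K ∪ (v ∗ lk_v K), covers of the deletion and of the link glue to a cover of K, and a
-- simplex has a cover without critical faces. For K ∈ 𝓕(n,d), split at the j ≤ d vertices of a minimal
-- non-face: the last link has ∅ as a non-face and is void. For K ∈ 𝓜(n,d), split at the j ≤ d vertices
-- outside a maximal face F: the last deletion is the simplex on F. Either way the number of critical
-- faces satisfies c(m) ≤ c(m-1) + ⋯ + c(m-j), hence c(m) ≤ q^m whenever q^d > 1 + q + ⋯ + q^(d-1),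
-- since q^(m-j) (1 + q + ⋯ + q^(j-1)) ≤ q^m for j ≤ d.
-- Faces of K are not decidable in general, but b ≤ q^n is, so by double negation they may be assumed so.

module Submission where

open import Defs
open import Level using (Level)
open import Algebra.Bundles using (CommutativeMonoid)
open import Data.Nat using (ℕ; _≤_)
open import Data.Sum using (_⊎_)
open import Data.Sum using (inj₁; inj₂)
open import Data.Product using (_,_)
open import Data.Fin.Subset using (⊤)
open import Data.Fin.Subset.Properties using (∣⊤∣≡n)
open import Data.Rational as ℚ using (1ℚ)
import Data.Rational.Properties as ℚₚ
open import Relation.Nullary using (Dec)
open import Relation.Nullary.Decidable using (decidable-stable)
open import Relation.Binary.PropositionalEquality using (subst₂)

module Subsets where

  open import Data.Nat using (zero; suc; _<_; z≤n; s≤s)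
  import Data.Nat.Properties as ℕₚ
  open import Data.Fin using (Fin; zero; suc; _≟_)
  open import Data.Vec using ([]; _∷_; lookup; _[_]≔_)
  open import Data.Vec.Properties
    using (≡-dec; lookup∘update; lookup∘update′; []≔-idempotent; []≔-commutes; []≔-lookup;
           tabulate∘lookup; tabulate-cong; lookup-replicate; []=⇒lookup; lookup⇒[]=)
  open import Data.Fin.Subset using (Subset; Side; inside; outside; ∣_∣; ⊥; _⊆_; _⊂_)
  open import Data.Bool using (true; false)
  import Data.Bool as Bool
  open import Data.Product using (Σ; _×_; _,_)
  open import Data.Sum using (inj₁; inj₂)
  open import Data.Empty using (⊥-elim)
  open import Relation.Nullary using (¬_; yes; no)
  open import Relation.Binary.Definitions using (DecidableEquality)
  open import Relation.Binary.PropositionalEquality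
  open import Function using (case_of_)

  private variable
    N : ℕ
    σ τ ρ W : Subset N
    v : Fin N

  in≢out : inside ≢ outside
  in≢out ()

  inside⊎outside : (b : Side) → b ≡ inside ⊎ b ≡ outside
  inside⊎outside true  = inj₁ refl
  inside⊎outside false = inj₂ refl

  ≢outside : ∀ {b} → b ≢ outside → b ≡ inside
  ≢outside {true}  ne = refl
  ≢outside {false} ne = ⊥-elim (ne refl)

  ≢inside : ∀ {b} → b ≢ inside → b ≡ outside
  ≢inside {true}  ne = ⊥-elim (ne refl)
  ≢inside {false} ne = refl

  infix 4 _≟ˢ_
  _≟ˢ_ : DecidableEquality (Subset N)
  _≟ˢ_ = ≡-dec Bool._≟_

  subset-ext : (∀ x → lookup σ x ≡ lookup τ x) → σ ≡ τ
  subset-ext {σ = σ} {τ} p =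
    trans (sym (tabulate∘lookup σ)) (trans (tabulate-cong p) (tabulate∘lookup τ))

  update-lookup : ∀ (σ : Subset N) v {b} → lookup σ v ≡ b → σ [ v ]≔ b ≡ σ
  update-lookup σ v refl = []≔-lookup σ v

  insert remove : Subset N → Fin N → Subset N
  insert σ v = σ [ v ]≔ inside
  remove σ v = σ [ v ]≔ outside

  insert-remove : ∀ (σ : Subset N) v → lookup σ v ≡ inside → insert (remove σ v) v ≡ σ
  insert-remove σ v σv = trans ([]≔-idempotent σ v) (update-lookup σ v σv)

  remove-insert : ∀ (σ : Subset N) v → lookup σ v ≡ outside → remove (insert σ v) v ≡ σ
  remove-insert σ v σv = trans ([]≔-idempotent σ v) (update-lookup σ v σv)

  ∣remove∣ : ∀ (σ : Subset N) v → lookup σ v ≡ inside → suc ∣ remove σ v ∣ ≡ ∣ σ ∣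
  ∣remove∣ (true  ∷ σ) zero    e = refl
  ∣remove∣ (true  ∷ σ) (suc v) e = cong suc (∣remove∣ σ v e)
  ∣remove∣ (false ∷ σ) (suc v) e = ∣remove∣ σ v e

  ∣insert∣ : ∀ (σ : Subset N) v → lookup σ v ≡ outside → ∣ insert σ v ∣ ≡ suc ∣ σ ∣
  ∣insert∣ (false ∷ σ) zero    e = refl
  ∣insert∣ (true  ∷ σ) (suc v) e = cong suc (∣insert∣ σ v e)
  ∣insert∣ (false ∷ σ) (suc v) e = ∣insert∣ σ v e

  nonempty⇒member : ∀ (σ : Subset N) {k} → ∣ σ ∣ ≡ suc k → Σ (Fin N) λ v → lookup σ v ≡ inside
  nonempty⇒member (true  ∷ σ) e = zero , refl
  nonempty⇒member (false ∷ σ) e with nonempty⇒member σ e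
  ... | v , σv = suc v , σv

  ∣∣≡0⇒outside : ∀ (σ : Subset N) → ∣ σ ∣ ≡ 0 → ∀ x → lookup σ x ≡ outside
  ∣∣≡0⇒outside (false ∷ σ) e zero    = refl
  ∣∣≡0⇒outside (false ∷ σ) e (suc x) = ∣∣≡0⇒outside σ e x

  lookup-⊥ : ∀ (x : Fin N) → lookup ⊥ x ≡ outside
  lookup-⊥ x = lookup-replicate x outside

  outside⇒≡⊥ : ∀ (σ : Subset N) → (∀ x → lookup σ x ≡ outside) → σ ≡ ⊥
  outside⇒≡⊥ σ p = subset-ext λ x → trans (p x) (sym (lookup-⊥ x))

  -- Inclusion phrased through lookup, the way updates _[_]≔_ are observed; a record, so that
  -- the two subsets can be inferred from a proof.
  infix 4 _⊑_
  record _⊑_ (τ σ : Subset N) : Set where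
    constructor ⊑-intro
    field
      mono : ∀ x → lookup τ x ≡ inside → lookup σ x ≡ inside
  open _⊑_ public

  ⊑-refl : σ ⊑ σ
  ⊑-refl .mono x l = l

  ⊑-trans : σ ⊑ τ → τ ⊑ ρ → σ ⊑ ρ
  ⊑-trans p q .mono x l = mono q x (mono p x l)

  ⊆⇒⊑ : τ ⊆ σ → τ ⊑ σ
  ⊆⇒⊑ {τ = τ} s .mono x l = []=⇒lookup (s (lookup⇒[]= x τ l))

  ⊑⇒⊆ : τ ⊑ σ → τ ⊆ σ
  ⊑⇒⊆ {σ = σ} s {x} m = lookup⇒[]= x σ (mono s x ([]=⇒lookup m))

  ⊑-outside : τ ⊑ σ → lookup σ v ≡ outside → lookup τ v ≡ outside
  ⊑-outside {v = v} s σv = ≢inside λ τv → in≢out (trans (sym (mono s v τv)) σv)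

  ⊑-tail : ∀ {a b} (τ σ : Subset N) → (a ∷ τ) ⊑ (b ∷ σ) → τ ⊑ σ
  ⊑-tail τ σ s .mono x = mono s (suc x)

  ⊑⇒∣∣≤ : ∀ (τ σ : Subset N) → τ ⊑ σ → ∣ τ ∣ ≤ ∣ σ ∣
  ⊑⇒∣∣≤ []          []          s = z≤n
  ⊑⇒∣∣≤ (true  ∷ τ) (true  ∷ σ) s = s≤s (⊑⇒∣∣≤ τ σ (⊑-tail τ σ s))
  ⊑⇒∣∣≤ (true  ∷ τ) (false ∷ σ) s with () ← mono s zero refl
  ⊑⇒∣∣≤ (false ∷ τ) (true  ∷ σ) s = ℕₚ.m≤n⇒m≤1+n (⊑⇒∣∣≤ τ σ (⊑-tail τ σ s))
  ⊑⇒∣∣≤ (false ∷ τ) (false ∷ σ) s = ⊑⇒∣∣≤ τ σ (⊑-tail τ σ s)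

  ⊑∧∣∣<⇒missing : ∀ (τ σ : Subset N) → τ ⊑ σ → ∣ τ ∣ < ∣ σ ∣ →
                  Σ (Fin N) λ v → lookup σ v ≡ inside × lookup τ v ≡ outside
  ⊑∧∣∣<⇒missing (true ∷ τ) (true ∷ σ) s (s≤s l) with ⊑∧∣∣<⇒missing τ σ (⊑-tail τ σ s) l
  ... | v , p = suc v , p
  ⊑∧∣∣<⇒missing (true  ∷ τ) (false ∷ σ) s l with () ← mono s zero refl
  ⊑∧∣∣<⇒missing (false ∷ τ) (true  ∷ σ) s l = zero , refl , refl
  ⊑∧∣∣<⇒missing (false ∷ τ) (false ∷ σ) s l with ⊑∧∣∣<⇒missing τ σ (⊑-tail τ σ s) l
  ... | v , p = suc v , p

  agree-except : ∀ {σ τ : Subset N} v → lookup σ v ≡ lookup τ v →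
                 (∀ x → x ≢ v → lookup σ x ≡ lookup τ x) → σ ≡ τ
  agree-except v at-v off-v = subset-ext λ x → case x ≟ v of λ where
    (yes refl) → at-v
    (no x≢v)   → off-v x x≢v

  infix 4 _⊏_
  _⊏_ : Subset N → Subset N → Set
  σ ⊏ τ = σ ⊑ τ × Σ (Fin _) λ x → lookup τ x ≡ inside × lookup σ x ≡ outside

  ⊂⇒⊏ : σ ⊂ τ → σ ⊏ τ
  ⊂⇒⊏ {σ = σ} (σ⊆τ , x , x∈τ , x∉σ) =
    ⊆⇒⊑ σ⊆τ , x , []=⇒lookup x∈τ , ≢inside λ σx → x∉σ (lookup⇒[]= x σ σx)

  ⊑∧⊀⇒∣∣≤ : σ ⊑ τ → ¬ σ ⊏ τ → ∣ τ ∣ ≤ ∣ σ ∣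
  ⊑∧⊀⇒∣∣≤ {σ = σ} {τ} σ⊑τ σ⊀τ with ℕₚ.≤-<-connex ∣ τ ∣ ∣ σ ∣
  ... | inj₁ τ≤σ = τ≤σ
  ... | inj₂ σ<τ = ⊥-elim (σ⊀τ (σ⊑τ , ⊑∧∣∣<⇒missing σ τ σ⊑τ σ<τ))

  empty⊑ : (∀ x → lookup σ x ≡ outside) → σ ⊑ τ
  empty⊑ p .mono x l = ⊥-elim (in≢out (trans (sym l) (p x)))

  remove⊑ : ∀ (σ : Subset N) v → remove σ v ⊑ σ
  remove⊑ σ v .mono x l with x ≟ v
  ... | yes refl = ⊥-elim (in≢out (trans (sym l) (lookup∘update v σ outside)))
  ... | no x≢v = trans (sym (lookup∘update′ x≢v σ outside)) l

  ⊑insert : ∀ (σ : Subset N) v → σ ⊑ insert σ v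
  ⊑insert σ v .mono x l with x ≟ v
  ... | yes refl = lookup∘update v σ inside
  ... | no x≢v = trans (lookup∘update′ x≢v σ inside) l

  ⊑remove : ∀ v → σ ⊑ W → lookup σ v ≡ outside → σ ⊑ remove W v
  ⊑remove {W = W} v s σv .mono x l with x ≟ v
  ... | yes refl = ⊥-elim (in≢out (trans (sym l) σv))
  ... | no x≢v = trans (lookup∘update′ x≢v W outside) (mono s x l)

  insert⊑ : ∀ v → σ ⊑ remove W v → lookup W v ≡ inside → insert σ v ⊑ W
  insert⊑ {σ = σ} {W = W} v s Wv .mono x l with x ≟ v
  ... | yes refl = Wv
  ... | no x≢v =
    trans (sym (lookup∘update′ x≢v W outside)) (mono s x (trans (sym (lookup∘update′ x≢v σ inside)) l))

  insert-mono : ∀ v → τ ⊑ σ → insert τ v ⊑ insert σ v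
  insert-mono {τ = τ} {σ = σ} v s .mono x l with x ≟ v
  ... | yes refl = lookup∘update v σ inside
  ... | no x≢v =
    trans (lookup∘update′ x≢v σ inside) (mono s x (trans (sym (lookup∘update′ x≢v τ inside)) l))

  ⊑insert⇒remove⊑ : ∀ v → ρ ⊑ insert σ v → remove ρ v ⊑ σ
  ⊑insert⇒remove⊑ {ρ = ρ} {σ = σ} v s .mono x l with x ≟ v
  ... | yes refl = ⊥-elim (in≢out (trans (sym l) (lookup∘update v ρ outside)))
  ... | no x≢v =
    trans (sym (lookup∘update′ x≢v σ inside)) (mono s x (trans (sym (lookup∘update′ x≢v ρ outside)) l))

  ⊑insert-remove : ∀ (ρ : Subset N) v → ρ ⊑ insert (remove ρ v) v
  ⊑insert-remove ρ v .mono x l with x ≟ v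
  ... | yes refl = lookup∘update v (remove ρ v) inside
  ... | no x≢v = trans (lookup∘update′ x≢v (remove ρ v) inside) (trans (lookup∘update′ x≢v ρ outside) l)

  ⊑∧∣∣≡⇒⊒ : ∀ (τ σ : Subset N) → τ ⊑ σ → ∣ τ ∣ ≡ ∣ σ ∣ → σ ⊑ τ
  ⊑∧∣∣≡⇒⊒ τ σ s e .mono x σx = ≢outside λ τx →
    ℕₚ.<-irrefl e (subst (_ ≤_) (∣remove∣ σ x σx) (s≤s (⊑⇒∣∣≤ τ (remove σ x) (⊑remove x s τx))))

module DoubleNegation {p : Level} where

  open import Data.Nat using (zero; suc)
  open import Data.Fin using (Fin; zero; suc)
  open import Data.Vec using ([]; _∷_)
  open import Data.Fin.Subset using (Subset)
  open import Data.Bool using (true; false)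
  open import Data.Product using (∃; _,_)
  open import Data.Sum using (inj₁; inj₂)
  open import Effect.Monad using (RawMonad)
  open import Relation.Nullary using (¬_; Dec; yes; no)
  open import Relation.Nullary.Decidable using (¬¬-excluded-middle)
  open import Relation.Nullary.Negation using (¬¬-Monad)
  open RawMonad (¬¬-Monad {p})

  ¬¬-decidable-on-subsets : ∀ n (P : Subset n → Set p) → ¬ ¬ (∀ σ → Dec (P σ))
  ¬¬-decidable-on-subsets zero P = do
    d ← ¬¬-excluded-middle
    pure λ { [] → d }
  ¬¬-decidable-on-subsets (suc n) P = do
    d₁ ← ¬¬-decidable-on-subsets n (λ σ → P (true ∷ σ))
    d₂ ← ¬¬-decidable-on-subsets n (λ σ → P (false ∷ σ))
    pure λ { (true ∷ σ) → d₁ σ ; (false ∷ σ) → d₂ σ }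

  ¬¬-all⊎counterexample : ∀ k (P : Fin k → Set p) → ¬ ¬ ((∀ j → P j) ⊎ ∃ λ j → ¬ P j)
  ¬¬-all⊎counterexample zero P = pure (inj₁ λ ())
  ¬¬-all⊎counterexample (suc k) P = do
    yes P0 ← ¬¬-excluded-middle
      where no ¬P0 → pure (inj₂ (zero , ¬P0))
    inj₁ all ← ¬¬-all⊎counterexample k (λ j → P (suc j))
      where inj₂ (j , ¬Pj) → pure (inj₂ (suc j , ¬Pj))
    pure (inj₁ λ { zero → P0 ; (suc j) → all j })

module FinSums {a ℓ} (M : CommutativeMonoid a ℓ) where

  open CommutativeMonoid M
  open import Algebra.Properties.CommutativeMonoid.Sum M public
    using (sum; sum-cong-≋; sum-cong-≗; sum-replicate-zero; sum-remove; ∑-distrib-+; ∑-comm)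
  open import Data.Nat as ℕ using (zero; suc)
  open import Data.Fin using (Fin; zero; suc; punchIn; _↑ˡ_; _↑ʳ_)
  open import Data.Fin.Properties using (punchInᵢ≢i)
  open import Data.List as List using (List; []; _∷_)
  open import Function using (_∘_)
  import Relation.Binary.PropositionalEquality as ≡
  open ≡ using (_≡_; _≢_)
  open import Relation.Binary.Reasoning.Setoid setoid

  foldr-map : ∀ {A B : Set} (f : B → Carrier) (g : A → B) l →
              List.foldr (λ x r → f x ∙ r) ε (List.map g l) ≡ List.foldr (λ x r → f (g x) ∙ r) ε l
  foldr-map f g []      = ≡.refl
  foldr-map f g (x ∷ l) = ≡.cong (f (g x) ∙_) (foldr-map f g l)

  foldr-allFinL≡sum : ∀ {m} (f : Fin m → Carrier) → List.foldr (λ j r → f j ∙ r) ε (allFinL m) ≡ sum f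
  foldr-allFinL≡sum {zero}  f = ≡.refl
  foldr-allFinL≡sum {suc m} f =
    ≡.cong (f zero ∙_) (≡.trans (foldr-map f suc (allFinL m)) (foldr-allFinL≡sum (f ∘ suc)))

  sum-zero : ∀ {m} {f : Fin m → Carrier} → (∀ i → f i ≈ ε) → sum f ≈ ε
  sum-zero {m} f≈ε = trans (sum-cong-≋ f≈ε) (sum-replicate-zero m)

  sum-single : ∀ {m} (f : Fin m → Carrier) u → (∀ i → i ≢ u → f i ≈ ε) → sum f ≈ f u
  sum-single {suc m} f u off-u = begin
    sum f                      ≈⟨ sum-remove {i = u} f ⟩
    f u ∙ sum (f ∘ punchIn u)  ≈⟨ ∙-congˡ (sum-zero λ i → off-u (punchIn u i) (punchInᵢ≢i u i)) ⟩
    f u ∙ ε                    ≈⟨ identityʳ (f u) ⟩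
    f u                        ∎

  sum-split : ∀ {a b} (f : Fin (a ℕ.+ b) → Carrier) → sum f ≈ sum (f ∘ (_↑ˡ b)) ∙ sum (f ∘ (a ↑ʳ_))
  sum-split {zero}      f = sym (identityˡ (sum f))
  sum-split {suc a} {b} f = begin
    f zero ∙ sum (f ∘ suc)
      ≈⟨ ∙-congˡ (sum-split {a} {b} (f ∘ suc)) ⟩
    f zero ∙ (sum (f ∘ suc ∘ (_↑ˡ b)) ∙ sum (f ∘ suc ∘ (a ↑ʳ_)))
      ≈⟨ sym (assoc (f zero) _ _) ⟩
    sum (f ∘ (_↑ˡ b)) ∙ sum (f ∘ (suc a ↑ʳ_))
      ∎

module GeometricSums where

  open import Data.Nat as ℕ using (zero; suc; _+_)
  import Data.Nat.Properties as ℕₚ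
  open import Data.Integer as ℤ using (+_)
  import Data.Integer.Properties as ℤₚ
  open import Data.Product using (_,_)
  open import Data.Rational as ℚ using (ℚ; 0ℚ; 1ℚ; mkℚ)
  import Data.Rational.Properties as ℚₚ
  import Data.Rational.Unnormalised as ℚᵘ
  import Data.Rational.Unnormalised.Properties as ℚᵘₚ
  import Data.Nat.Coprimality as Coprimality
  open import Data.Empty using (⊥-elim)
  open import Relation.Nullary using (yes; no)
  open import Relation.Binary.PropositionalEquality

  ℕtoℚ≡mkℚ : ∀ k → ℕtoℚ k ≡ mkℚ (+ k) 0 (Coprimality.sym (Coprimality.1-coprimeTo k))
  ℕtoℚ≡mkℚ k = ℚₚ.normalize-coprime (Coprimality.sym (Coprimality.1-coprimeTo k))

  ℕtoℚ-+ : ∀ a b → ℕtoℚ (a + b) ≡ ℕtoℚ a ℚ.+ ℕtoℚ b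
  ℕtoℚ-+ a b = ℚₚ.toℚᵘ-injective (ℚᵘₚ.≃-trans as-fractions (ℚᵘₚ.≃-sym (ℚₚ.toℚᵘ-homo-+ (ℕtoℚ a) (ℕtoℚ b))))
    where
    as-fractions : ℚ.toℚᵘ (ℕtoℚ (a + b)) ℚᵘ.≃ (ℚ.toℚᵘ (ℕtoℚ a) ℚᵘ.+ ℚ.toℚᵘ (ℕtoℚ b))
    as-fractions rewrite ℕtoℚ≡mkℚ (a + b) | ℕtoℚ≡mkℚ a | ℕtoℚ≡mkℚ b = ℚᵘ.*≡* cross-multiplied
      where
      cross-multiplied : + (a + b) ℤ.* + 1 ≡ (+ a ℤ.* + 1 ℤ.+ + b ℤ.* + 1) ℤ.* + 1
      cross-multiplied rewrite ℤₚ.*-identityʳ (+ a) | ℤₚ.*-identityʳ (+ b) | ℤₚ.*-identityʳ (+ (a + b))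
        = ℤₚ.pos-+ a b

  ℕtoℚ-nonNeg : ∀ k → 0ℚ ℚ.≤ ℕtoℚ k
  ℕtoℚ-nonNeg k rewrite ℕtoℚ≡mkℚ k = ℚₚ.nonNegative⁻¹ _

  ℕtoℚ-mono : ∀ {a b} → a ℕ.≤ b → ℕtoℚ a ℚ.≤ ℕtoℚ b
  ℕtoℚ-mono {a} a≤b with k , refl ← ℕₚ.m≤n⇒∃[o]m+o≡n a≤b =
    subst₂ ℚ._≤_ (ℚₚ.+-identityʳ (ℕtoℚ a)) (sym (ℕtoℚ-+ a k))
                 (ℚₚ.+-monoʳ-≤ (ℕtoℚ a) (ℕtoℚ-nonNeg k))

  0≤1 : 0ℚ ℚ.≤ 1ℚ
  0≤1 = ℚₚ.<⇒≤ (ℚₚ.positive⁻¹ 1ℚ)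

  *-monoˡ-≤-nonNeg : ∀ {p a b} → 0ℚ ℚ.≤ p → a ℚ.≤ b → p ℚ.* a ℚ.≤ p ℚ.* b
  *-monoˡ-≤-nonNeg {p} 0≤p = ℚₚ.*-monoˡ-≤-nonNeg p {{ℚ.nonNegative 0≤p}}

  *-nonNeg : ∀ {p r} → 0ℚ ℚ.≤ p → 0ℚ ℚ.≤ r → 0ℚ ℚ.≤ p ℚ.* r
  *-nonNeg {p} {r} 0≤p 0≤r = subst (ℚ._≤ p ℚ.* r) (ℚₚ.*-zeroʳ p) (*-monoˡ-≤-nonNeg 0≤p 0≤r)

  module _ (q : ℚ) where

    powℚ-+ : ∀ a b → powℚ q (a + b) ≡ powℚ q a ℚ.* powℚ q b
    powℚ-+ zero    b = sym (ℚₚ.*-identityˡ (powℚ q b))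
    powℚ-+ (suc a) b = trans (cong (q ℚ.*_) (powℚ-+ a b)) (sym (ℚₚ.*-assoc q (powℚ q a) (powℚ q b)))

    powℚ-nonNeg : 0ℚ ℚ.≤ q → ∀ m → 0ℚ ℚ.≤ powℚ q m
    powℚ-nonNeg 0≤q zero    = 0≤1
    powℚ-nonNeg 0≤q (suc m) = *-nonNeg 0≤q (powℚ-nonNeg 0≤q m)

    powℚ-≥1 : 1ℚ ℚ.≤ q → ∀ m → 1ℚ ℚ.≤ powℚ q m
    powℚ-≥1 1≤q zero    = ℚₚ.≤-refl
    powℚ-≥1 1≤q (suc m) = ℚₚ.≤-trans 1≤q (subst (ℚ._≤ q ℚ.* powℚ q m) (ℚₚ.*-identityʳ q)
                             (*-monoˡ-≤-nonNeg (ℚₚ.≤-trans 0≤1 1≤q) (powℚ-≥1 1≤q m)))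

    geomℚ-horner : ∀ j → geomℚ q (suc j) ≡ 1ℚ ℚ.+ q ℚ.* geomℚ q j
    geomℚ-horner zero = cong (1ℚ ℚ.+_) (sym (ℚₚ.*-zeroʳ q))
    geomℚ-horner (suc j) = begin
      qʲ⁺¹ ℚ.+ geomℚ q (suc j)            ≡⟨ cong (qʲ⁺¹ ℚ.+_) (geomℚ-horner j) ⟩
      qʲ⁺¹ ℚ.+ (1ℚ ℚ.+ q ℚ.* geomℚ q j)   ≡⟨ sym (ℚₚ.+-assoc qʲ⁺¹ 1ℚ (q ℚ.* geomℚ q j)) ⟩
      (qʲ⁺¹ ℚ.+ 1ℚ) ℚ.+ q ℚ.* geomℚ q j   ≡⟨ cong (ℚ._+ q ℚ.* geomℚ q j) (ℚₚ.+-comm qʲ⁺¹ 1ℚ) ⟩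
      (1ℚ ℚ.+ qʲ⁺¹) ℚ.+ q ℚ.* geomℚ q j   ≡⟨ ℚₚ.+-assoc 1ℚ qʲ⁺¹ (q ℚ.* geomℚ q j) ⟩
      1ℚ ℚ.+ (qʲ⁺¹ ℚ.+ q ℚ.* geomℚ q j)   ≡⟨ cong (1ℚ ℚ.+_) (sym (ℚₚ.*-distribˡ-+ q _ _)) ⟩
      1ℚ ℚ.+ q ℚ.* geomℚ q (suc j)        ∎
      where
      open ≡-Reasoning
      qʲ⁺¹ = q ℚ.* powℚ q j

    -- Once q^j ≤ 1 + q + ⋯ + q^(j-1), multiplying by q and adding 1 keeps it so forever.
    pow≤geom-persists : 0ℚ ℚ.≤ q → ∀ j k → powℚ q j ℚ.≤ geomℚ q j →
                        powℚ q (k + j) ℚ.≤ geomℚ q (k + j)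
    pow≤geom-persists 0≤q j zero    p≤g = p≤g
    pow≤geom-persists 0≤q j (suc k) p≤g =
      subst (powℚ q (suc k + j) ℚ.≤_) (sym (geomℚ-horner (k + j)))
        (ℚₚ.≤-trans (*-monoˡ-≤-nonNeg 0≤q (pow≤geom-persists 0≤q j k p≤g))
                    (subst (ℚ._≤ 1ℚ ℚ.+ q ℚ.* geomℚ q (k + j)) (ℚₚ.+-identityˡ (q ℚ.* geomℚ q (k + j)))
                           (ℚₚ.+-monoˡ-≤ (q ℚ.* geomℚ q (k + j)) 0≤1)))

    module _ {d : ℕ} (0≤q : 0ℚ ℚ.≤ q) (θ<q : geomℚ q d ℚ.< powℚ q d) where

      geom≤pow : ∀ {j} → j ℕ.≤ d → geomℚ q j ℚ.≤ powℚ q j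
      geom≤pow {j} j≤d with powℚ q j ℚₚ.≤? geomℚ q j
      ... | no  p≰g = ℚₚ.<⇒≤ (ℚₚ.≰⇒> p≰g)
      ... | yes p≤g with k , refl ← ℕₚ.m≤n⇒∃[o]m+o≡n j≤d =
        ⊥-elim (ℚₚ.<-irrefl refl (ℚₚ.<-≤-trans θ<q (subst (λ i → powℚ q i ℚ.≤ geomℚ q i) (ℕₚ.+-comm k j)
                                                           (pow≤geom-persists 0≤q j k p≤g))))

      pow*geom≤pow : ∀ r {j} → j ℕ.≤ d → powℚ q r ℚ.* geomℚ q j ℚ.≤ powℚ q (r + j)
      pow*geom≤pow r {j} j≤d =
        subst (powℚ q r ℚ.* geomℚ q j ℚ.≤_) (sym (powℚ-+ r j))
              (*-monoˡ-≤-nonNeg (powℚ-nonNeg 0≤q r) (geom≤pow j≤d))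

    pow*geom-suc : ∀ r j → powℚ q r ℚ.* geomℚ q (suc j) ≡ powℚ q (r + j) ℚ.+ powℚ q r ℚ.* geomℚ q j
    pow*geom-suc r j = trans (ℚₚ.*-distribˡ-+ (powℚ q r) (powℚ q j) (geomℚ q j))
                             (cong (ℚ._+ powℚ q r ℚ.* geomℚ q j) (sym (powℚ-+ r j)))

module MorseCovers where

  open Subsets
  open import Data.Nat using (zero; suc; _+_)
  import Data.Nat.Properties as ℕₚ
  open import Data.Fin using (Fin; _≟_)
  open import Data.Fin.Properties using (any?)
  open import Data.Vec using (lookup; _[_]≔_)
  open import Data.Vec.Properties using (lookup∘update; lookup∘update′; []≔-commutes)
  open import Data.Fin.Subset using (Subset; inside; outside; ∣_∣; ⊥)
  import Data.Bool as Bool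
  open import Data.List using (List; []; _∷_; map; _++_; length)
  open import Data.List.Properties using (length-++; length-map)
  open import Data.List.Membership.Propositional using (_∈_)
  open import Data.List.Membership.Propositional.Properties using (∈-map⁺; ∈-map⁻; ∈-++⁺ˡ; ∈-++⁺ʳ)
  open import Data.List.Relation.Unary.All using (All; [])
  import Data.List.Relation.Unary.All as All
  import Data.List.Relation.Unary.All.Properties as Allₚ
  open import Data.List.Relation.Unary.AllPairs using (AllPairs; []; _∷_)
  import Data.List.Relation.Unary.AllPairs as AllPairs
  import Data.List.Relation.Unary.AllPairs.Properties as AllPairsₚ
  open import Data.List.Relation.Unary.Any using (here)
  open import Data.Product using (Σ; _×_; _,_; proj₁; proj₂)
  open import Data.Sum using (inj₁; inj₂)
  open import Data.Empty using (⊥-elim)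
  open import Relation.Nullary using (¬_; Dec; yes; no; _×-dec_)
  open import Relation.Binary.PropositionalEquality

  private variable
    N : ℕ

  record DecComplex (N : ℕ) : Set₁ where
    field
      Face   : Subset N → Set
      face?  : ∀ σ → Dec (Face σ)
      face-⊑ : ∀ {σ τ} → τ ⊑ σ → Face σ → Face τ
  open DecComplex public

  deletion : Fin N → DecComplex N → DecComplex N
  deletion v K = record
    { Face   = λ σ → Face K σ × lookup σ v ≡ outside
    ; face?  = λ σ → face? K σ ×-dec (lookup σ v Bool.≟ outside)
    ; face-⊑ = λ s (f , σv) → face-⊑ K s f , ⊑-outside s σv
    }

  link : Fin N → DecComplex N → DecComplex N
  link v K = record
    { Face   = λ σ → lookup σ v ≡ outside × Face K (insert σ v)
    ; face?  = λ σ → (lookup σ v Bool.≟ outside) ×-dec face? K (insert σ v)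
    ; face-⊑ = λ s (σv , f) → ⊑-outside s σv , face-⊑ K (insert-mono v s) f
    }

  infix 4 _⋖_
  _⋖_ : Subset N → Subset N → Set
  ρ ⋖ σ = Σ (Fin _) λ u → lookup σ u ≡ inside × ρ ≡ remove σ u

  infix 4 _⋖?_
  _⋖?_ : (ρ σ : Subset N) → Dec (ρ ⋖ σ)
  ρ ⋖? σ = any? λ u → (lookup σ u Bool.≟ inside) ×-dec (ρ ≟ˢ remove σ u)

  ⋖-outside : ∀ {ρ σ : Subset N} {v} → lookup σ v ≡ outside → ρ ⋖ σ → lookup ρ v ≡ outside
  ⋖-outside {σ = σ} {v} σv (u , _ , refl) = ⊑-outside (remove⊑ σ u) σv

  ⋖-insert⁻ : ∀ {ρ σ : Subset N} {v} → lookup ρ v ≡ outside → lookup σ v ≡ outside →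
              insert ρ v ⋖ insert σ v → ρ ⋖ σ
  ⋖-insert⁻ {ρ = ρ} {σ} {v} ρv σv (w , w∈ , eq) with w ≟ v
  ... | yes refl = ⊥-elim (in≢out (trans (sym (lookup∘update v ρ inside))
                     (trans (cong (λ τ → lookup τ v) eq) (lookup∘update v (insert σ v) outside))))
  ... | no w≢v = w , trans (sym (lookup∘update′ w≢v σ inside)) w∈ , (begin
      ρ                                 ≡⟨ sym (remove-insert ρ v ρv) ⟩
      remove (insert ρ v) v             ≡⟨ cong (λ τ → remove τ v) eq ⟩
      remove (remove (insert σ v) w) v  ≡⟨ []≔-commutes (insert σ v) w v w≢v ⟩
      remove (remove (insert σ v) v) w  ≡⟨ cong (λ τ → remove τ w) (remove-insert σ v σv) ⟩
      remove σ w                        ∎)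
    where open ≡-Reasoning

  -- A pair (top , pivot) stands for the two faces top and top ∖ pivot.
  record MatchedPair (K : DecComplex N) : Set where
    constructor matched
    field
      top      : Subset N
      pivot    : Fin N
      top-face : Face K top
      pivot∈   : lookup top pivot ≡ inside

    bot : Subset N
    bot = remove top pivot
  open MatchedPair public

  -- Unlike in a Morse matching the pairs need not be disjoint: covering and triangularity are all that
  -- the Morse inequality b(K) ≤ #critical uses.
  record MorseCover (K : DecComplex N) : Set where
    field
      critical   : List (Subset N)
      pairs      : List (MatchedPair K)
      covers     : ∀ σ → Face K σ → σ ∈ critical ⊎ σ ∈ map top pairs ⊎ σ ∈ map bot pairs
      triangular : AllPairs (λ p p′ → ¬ bot p ⋖ top p′) pairs
  open MorseCover public

  ∈-map-≡ : ∀ {A B : Set} (f : A → B) {xs x y} → x ∈ xs → y ≡ f x → y ∈ map f xs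
  ∈-map-≡ f x∈ refl = ∈-map⁺ f x∈

  module _ {K : DecComplex N} {v : Fin N} where

    liftDeletion : MatchedPair (deletion v K) → MatchedPair K
    liftDeletion p = matched (top p) (pivot p) (proj₁ (top-face p)) (pivot∈ p)

    liftLink : MatchedPair (link v K) → MatchedPair K
    liftLink p =
      matched (insert (top p) v) (pivot p) (proj₂ (top-face p)) (mono (⊑insert (top p) v) (pivot p) (pivot∈ p))

    bot-outside : (p : MatchedPair (link v K)) → lookup (bot p) v ≡ outside
    bot-outside p = ⊑-outside (remove⊑ (top p) (pivot p)) (proj₁ (top-face p))

    bot-liftLink : (p : MatchedPair (link v K)) → bot (liftLink p) ≡ insert (bot p) v
    bot-liftLink p = []≔-commutes (top p) v (pivot p) v≢pivot
      where
      v≢pivot : v ≢ pivot p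
      v≢pivot refl = in≢out (trans (sym (pivot∈ p)) (proj₁ (top-face p)))

    triangular-liftLink : (p q : MatchedPair (link v K)) →
                          ¬ bot p ⋖ top q → ¬ bot (liftLink p) ⋖ top (liftLink q)
    triangular-liftLink p q p⋪q p⋖q = p⋪q (⋖-insert⁻ (bot-outside p) (proj₁ (top-face q))
                                                    (subst (_⋖ top (liftLink q)) (bot-liftLink p) p⋖q))

    triangular-link-deletion : (p : MatchedPair (link v K)) (q : MatchedPair (deletion v K)) →
                               ¬ bot (liftLink p) ⋖ top (liftDeletion q)
    triangular-link-deletion p q p⋖q = in≢out (trans (sym v∈bot) (⋖-outside (proj₂ (top-face q)) p⋖q))
      where
      v∈bot : lookup (bot (liftLink p)) v ≡ inside
      v∈bot = trans (cong (λ τ → lookup τ v) (bot-liftLink p)) (lookup∘update v (bot p) inside)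

    module _ (M₁ : MorseCover (deletion v K)) (M₂ : MorseCover (link v K)) where

      gluedCritical : List (Subset N)
      gluedCritical = critical M₁ ++ map (λ σ → insert σ v) (critical M₂)

      gluedPairs : List (MatchedPair K)
      gluedPairs = map liftLink (pairs M₂) ++ map liftDeletion (pairs M₁)

      -- A face without v is a face of the deletion; a face with v is σ ∪ v for a face σ of the link.
      glued-covers : ∀ σ → Face K σ → σ ∈ gluedCritical ⊎ σ ∈ map top gluedPairs ⊎ σ ∈ map bot gluedPairs
      glued-covers σ f with inside⊎outside (lookup σ v)
      ... | inj₂ σv with covers M₁ σ (f , σv)
      ...   | inj₁ m = inj₁ (∈-++⁺ˡ m)
      ...   | inj₂ (inj₁ m) with p , p∈ , eq ← ∈-map⁻ top m =
        inj₂ (inj₁ (∈-map-≡ top (∈-++⁺ʳ _ (∈-map⁺ liftDeletion p∈)) eq))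
      ...   | inj₂ (inj₂ m) with p , p∈ , eq ← ∈-map⁻ bot m =
        inj₂ (inj₂ (∈-map-≡ bot (∈-++⁺ʳ _ (∈-map⁺ liftDeletion p∈)) eq))
      glued-covers σ f | inj₁ σv
        with covers M₂ (remove σ v) (lookup∘update v σ outside , subst (Face K) (sym (insert-remove σ v σv)) f)
      ... | inj₁ m = inj₁ (∈-++⁺ʳ _ (∈-map-≡ (λ τ → insert τ v) m (sym (insert-remove σ v σv))))
      ... | inj₂ (inj₁ m) with p , p∈ , eq ← ∈-map⁻ top m =
        inj₂ (inj₁ (∈-map-≡ top (∈-++⁺ˡ (∈-map⁺ liftLink p∈))
                     (trans (sym (insert-remove σ v σv)) (cong (λ τ → insert τ v) eq))))
      ... | inj₂ (inj₂ m) with p , p∈ , eq ← ∈-map⁻ bot m =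
        inj₂ (inj₂ (∈-map-≡ bot (∈-++⁺ˡ (∈-map⁺ liftLink p∈))
                     (trans (sym (insert-remove σ v σv)) (trans (cong (λ τ → insert τ v) eq) (sym (bot-liftLink p))))))

      glued-triangular : AllPairs (λ p p′ → ¬ bot p ⋖ top p′) gluedPairs
      glued-triangular =
        AllPairsₚ.++⁺ (AllPairsₚ.map⁺ (AllPairs.map (λ {p} {q} → triangular-liftLink p q) (triangular M₂)))
                      (AllPairsₚ.map⁺ (triangular M₁))
                      (Allₚ.map⁺ (All.universal (λ p → Allₚ.map⁺ (All.universal (triangular-link-deletion p) _)) _))

      -- K is the union of its deletion and the cone over the link of v.
      glue : MorseCover K
      glue = record
        { critical = gluedCritical ; pairs = gluedPairs ; covers = glued-covers ; triangular = glued-triangular }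

      ∣critical-glue∣ : length (critical glue) ≡ length (critical M₁) + length (critical M₂)
      ∣critical-glue∣ = trans (length-++ (critical M₁)) (cong (length (critical M₁) +_) (length-map _ (critical M₂)))

  toDecComplex : (K : SimplicialComplex N) → (∀ σ → Dec (IsFace K σ)) → DecComplex N
  toDecComplex K face? = record
    { Face = IsFace K ; face? = face? ; face-⊑ = λ {σ} {τ} τ⊑σ → down-closed K σ τ (⊑⇒⊆ τ⊑σ) }

  SupportedOn : DecComplex N → Subset N → Set
  SupportedOn K W = ∀ σ → Face K σ → σ ⊑ W

  module _ (K : DecComplex N) {W : Subset N} (v : Fin N) (K⊑W : SupportedOn K W) where

    supportedOn-deletion : SupportedOn (deletion v K) (remove W v)
    supportedOn-deletion σ (f , σv) = ⊑remove v (K⊑W σ f) σv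

    supportedOn-link : SupportedOn (link v K) (remove W v)
    supportedOn-link σ (σv , f) = ⊑remove v (⊑-trans (⊑insert σ v) (K⊑W (insert σ v) f)) σv

  emptyCover : {K : DecComplex N} → (∀ σ → ¬ Face K σ) → MorseCover K
  emptyCover K-empty = record
    { critical = [] ; pairs = [] ; covers = λ σ f → ⊥-elim (K-empty σ f) ; triangular = [] }

  pointCover : {K : DecComplex N} → (∀ σ → Face K σ → σ ≡ ⊥) → MorseCover K
  pointCover K-point = record
    { critical = ⊥ ∷ [] ; pairs = [] ; covers = λ σ f → inj₁ (here (K-point σ f)) ; triangular = [] }

  -- The hypotheses say that K is the full simplex on W.
  simplexCover : ∀ m {K : DecComplex N} {W} → ∣ W ∣ ≡ suc m → SupportedOn K W → Face K W →
                 Σ (MorseCover K) λ M → critical M ≡ []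
  simplexCover m {K} {W} ∣W∣ K⊑W W-face with nonempty⇒member W ∣W∣
  simplexCover zero {K} {W} ∣W∣ K⊑W W-face | v , Wv = record
    { critical = [] ; pairs = matched W v W-face Wv ∷ [] ; covers = covers′ ; triangular = [] ∷ [] } , refl
    where
    W∖v-empty : ∀ x → lookup (remove W v) x ≡ outside
    W∖v-empty = ∣∣≡0⇒outside (remove W v) (ℕₚ.suc-injective (trans (∣remove∣ W v Wv) ∣W∣))
    off-v : ∀ σ → Face K σ → ∀ x → x ≢ v → lookup σ x ≡ lookup (remove W v) x
    off-v σ f x x≢v = trans (⊑-outside (K⊑W σ f) (trans (sym (lookup∘update′ x≢v W outside)) (W∖v-empty x)))
                            (sym (W∖v-empty x))
    covers′ : ∀ σ → Face K σ → σ ∈ [] ⊎ σ ∈ W ∷ [] ⊎ σ ∈ remove W v ∷ []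
    covers′ σ f with inside⊎outside (lookup σ v)
    ... | inj₁ σv = inj₂ (inj₁ (here (agree-except v (trans σv (sym Wv))
                                         λ x x≢v → trans (off-v σ f x x≢v) (lookup∘update′ x≢v W outside))))
    ... | inj₂ σv = inj₂ (inj₂ (here (agree-except v (trans σv (sym (lookup∘update v W outside))) (off-v σ f))))
  simplexCover (suc m) {K} {W} ∣W∣ K⊑W W-face | v , Wv =
    glue (proj₁ M₁) (proj₁ M₂) ,
    cong₂ (λ c₁ c₂ → c₁ ++ map (λ σ → insert σ v) c₂) (proj₂ M₁) (proj₂ M₂)
    where
    ∣W∖v∣ : ∣ remove W v ∣ ≡ suc m
    ∣W∖v∣ = ℕₚ.suc-injective (trans (∣remove∣ W v Wv) ∣W∣)
    M₁ = simplexCover m {deletion v K} ∣W∖v∣ (supportedOn-deletion K v K⊑W)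
                       (face-⊑ K (remove⊑ W v) W-face , lookup∘update v W outside)
    M₂ = simplexCover m {link v K} ∣W∖v∣ (supportedOn-link K v K⊑W)
                       (lookup∘update v W outside , subst (Face K) (sym (insert-remove W v Wv)) W-face)

module CriticalBounds where

  open Subsets
  open MorseCovers
  open GeometricSums
  open import Data.Nat as ℕ using (zero; suc; _+_; _∸_; _<_; z≤n; s≤s)
  import Data.Nat.Properties as ℕₚ
  open import Data.Nat.Induction using (<-rec)
  open import Data.Fin using (Fin)
  open import Data.Vec using (lookup)
  open import Data.Vec.Properties using (lookup∘update; lookup∘update′)
  open import Data.Fin.Subset using (Subset; inside; outside; ∣_∣; ⊥)
  open import Data.List using (List; []; _∷_; length; allFin)
  open import Data.List.Membership.Propositional using (_∈_)
  open import Data.List.Membership.Propositional.Properties using (∈-allFin)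
  open import Data.List.Relation.Unary.Any using (here; there)
  open import Data.Product using (Σ; _×_; _,_; proj₁; proj₂)
  open import Data.Sum using (inj₁; inj₂)
  open import Data.Empty using (⊥-elim)
  open import Data.Rational as ℚ using (ℚ; 0ℚ; 1ℚ)
  import Data.Rational.Properties as ℚₚ
  open import Function using (_∘_)
  open import Relation.Nullary using (¬_; yes; no)
  open import Relation.Binary.PropositionalEquality

  private variable
    N : ℕ

  CoverWithin : DecComplex N → ℚ → Set
  CoverWithin K x = Σ (MorseCover K) λ M → ℕtoℚ (length (critical M)) ℚ.≤ x

  glueWithin : ∀ {K : DecComplex N} v {x y} → CoverWithin (deletion v K) x → CoverWithin (link v K) y →
               CoverWithin K (x ℚ.+ y)
  glueWithin {K = K} v (M₁ , M₁≤x) (M₂ , M₂≤y) =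
    glue M₁ M₂ ,
    subst (ℚ._≤ _) (sym (trans (cong ℕtoℚ (∣critical-glue∣ {K = K} {v = v} M₁ M₂))
                               (ℕtoℚ-+ (length (critical M₁)) (length (critical M₂)))))
          (ℚₚ.+-mono-≤ M₁≤x M₂≤y)

  within-mono : ∀ {K : DecComplex N} {x y} → CoverWithin K x → x ℚ.≤ y → CoverWithin K y
  within-mono (M , M≤x) x≤y = M , ℚₚ.≤-trans M≤x x≤y

  simplexWithin : ∀ m {K : DecComplex N} {W x} → ∣ W ∣ ≡ suc m → SupportedOn K W → Face K W → 0ℚ ℚ.≤ x →
                  CoverWithin K x
  simplexWithin m {K} ∣W∣ K⊑W W-face 0≤x with M , refl ← simplexCover m {K} ∣W∣ K⊑W W-face = M , 0≤x

  SmallNonFaces : ℕ → DecComplex N → Subset N → Set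
  SmallNonFaces d K W =
    ∀ σ → σ ⊑ W → ¬ Face K σ → Σ (Subset _) λ ρ → ρ ⊑ σ × ¬ Face K ρ × ∣ ρ ∣ ℕ.≤ d

  module _ {d} (K : DecComplex N) {W : Subset N} (v : Fin N) (small : SmallNonFaces d K W) where

    smallNonFaces-deletion : SmallNonFaces d (deletion v K) (remove W v)
    smallNonFaces-deletion σ σ⊑W∖v σ∉
      with ρ , ρ⊑σ , ρ∉ , ∣ρ∣≤d ← small σ (⊑-trans σ⊑W∖v (remove⊑ W v))
                                         (λ f → σ∉ (f , ⊑-outside σ⊑W∖v (lookup∘update v W outside)))
      = ρ , ρ⊑σ , ρ∉ ∘ proj₁ , ∣ρ∣≤d

    smallNonFaces-link : lookup W v ≡ inside → SmallNonFaces d (link v K) (remove W v)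
    smallNonFaces-link Wv σ σ⊑W∖v σ∉
      with ρ , ρ⊑σ+v , ρ∉ , ∣ρ∣≤d ← small (insert σ v) (insert⊑ v σ⊑W∖v Wv)
                                           (λ f → σ∉ (⊑-outside σ⊑W∖v (lookup∘update v W outside) , f))
      = remove ρ v , ⊑insert⇒remove⊑ v ρ⊑σ+v , (λ f → ρ∉ (face-⊑ K (⊑insert-remove ρ v) (proj₂ f))) ,
        ℕₚ.≤-trans (⊑⇒∣∣≤ _ _ (remove⊑ ρ v)) ∣ρ∣≤d

  IsMaximal : DecComplex N → Subset N → Set
  IsMaximal K σ = Face K σ × (∀ τ → σ ⊏ τ → ¬ Face K τ)

  module _ (K : DecComplex N) where

    extend : List (Fin N) → Subset N → Subset N
    extend []       F = F
    extend (x ∷ xs) F with face? K (insert F x)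
    ... | yes _ = extend xs (insert F x)
    ... | no  _ = extend xs F

    ⊑extend : ∀ xs F → F ⊑ extend xs F
    ⊑extend []       F = ⊑-refl
    ⊑extend (x ∷ xs) F with face? K (insert F x)
    ... | yes _ = ⊑-trans (⊑insert F x) (⊑extend xs (insert F x))
    ... | no  _ = ⊑extend xs F

    extend-face : ∀ xs {F} → Face K F → Face K (extend xs F)
    extend-face []       f = f
    extend-face (x ∷ xs) {F} f with face? K (insert F x)
    ... | yes f′ = extend-face xs f′
    ... | no  _  = extend-face xs f

    extend-saturated : ∀ xs F {y} → y ∈ xs → Face K (insert (extend xs F) y) → lookup (extend xs F) y ≡ inside
    extend-saturated (x ∷ xs) F y∈ f with face? K (insert F x)
    extend-saturated (x ∷ xs) F (here refl) f | yes _ = mono (⊑extend xs (insert F x)) x (lookup∘update x F inside)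
    extend-saturated (x ∷ xs) F (here refl) f | no F+x∉ = ⊥-elim (F+x∉ (face-⊑ K (insert-mono x (⊑extend xs F)) f))
    extend-saturated (x ∷ xs) F (there y∈) f | yes _ = extend-saturated xs (insert F x) y∈ f
    extend-saturated (x ∷ xs) F (there y∈) f | no  _ = extend-saturated xs F y∈ f

    maximalExtension : ∀ F → Face K F → Σ (Subset N) λ H → F ⊑ H × IsMaximal K H
    maximalExtension F f = H , ⊑extend (allFin _) F , extend-face (allFin _) f , H-maximal
      where
      H = extend (allFin _) F
      H-maximal : ∀ τ → H ⊏ τ → ¬ Face K τ
      H-maximal τ (H⊑τ , x , τx , Hx) τ-face = in≢out (trans (sym Hx∈) Hx)
        where
        Hx∈ = extend-saturated (allFin _) F (∈-allFin x) (face-⊑ K (insert⊑ x (⊑remove x H⊑τ Hx) τx) τ-face)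

  LargeMaximalFaces : ℕ → DecComplex N → Subset N → Set
  LargeMaximalFaces d K W = ∀ σ → IsMaximal K σ → ∣ W ∣ ℕ.≤ ∣ σ ∣ + d

  module _ {d} (K : DecComplex N) {W : Subset N} (v : Fin N) (Wv : lookup W v ≡ inside)
           (large : LargeMaximalFaces d K W) where

    largeMaximalFaces-deletion : LargeMaximalFaces d (deletion v K) (remove W v)
    largeMaximalFaces-deletion G ((G-face , Gv) , G-max)
      with H , G⊑H , H-max ← maximalExtension K G G-face | inside⊎outside (lookup H v)
    ... | inj₂ Hv = ℕₚ.≤-trans (⊑⇒∣∣≤ _ _ (remove⊑ W v))
                      (ℕₚ.≤-trans (large H H-max)
                        (ℕₚ.+-monoˡ-≤ d (⊑∧⊀⇒∣∣≤ G⊑H λ G⊏H → G-max H G⊏H (proj₁ H-max , Hv))))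
    ... | inj₁ Hv = ℕ.s≤s⁻¹ (begin
      suc ∣ remove W v ∣      ≡⟨ ∣remove∣ W v Wv ⟩
      ∣ W ∣                   ≤⟨ large H H-max ⟩
      ∣ H ∣ + d               ≡⟨ cong (_+ d) (sym (∣remove∣ H v Hv)) ⟩
      suc (∣ remove H v ∣ + d) ≤⟨ s≤s (ℕₚ.+-monoˡ-≤ d (⊑∧⊀⇒∣∣≤ (⊑remove v G⊑H Gv) G⊀H∖v)) ⟩
      suc (∣ G ∣ + d)         ∎)
      where
      open ℕₚ.≤-Reasoning
      G⊀H∖v : ¬ G ⊏ remove H v
      G⊀H∖v G⊏ = G-max _ G⊏ (face-⊑ K (remove⊑ H v) (proj₁ H-max) , lookup∘update v H outside)

    largeMaximalFaces-link : LargeMaximalFaces d (link v K) (remove W v)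
    largeMaximalFaces-link G ((Gv , G+v-face) , G-max) = ℕ.s≤s⁻¹ (begin
      suc ∣ remove W v ∣ ≡⟨ ∣remove∣ W v Wv ⟩
      ∣ W ∣              ≤⟨ large (insert G v) (G+v-face , G+v-max) ⟩
      ∣ insert G v ∣ + d ≡⟨ cong (_+ d) (∣insert∣ G v Gv) ⟩
      suc (∣ G ∣ + d)    ∎)
      where
      open ℕₚ.≤-Reasoning
      G+v-max : ∀ τ → insert G v ⊏ τ → ¬ Face K τ
      G+v-max τ (G+v⊑τ , x , τx , G+v-x) τ-face =
        G-max (remove τ v) (⊑remove v (⊑-trans (⊑insert G v) G+v⊑τ) Gv , x ,
                            trans (lookup∘update′ x≢v τ outside) τx ,
                            trans (sym (lookup∘update′ x≢v G inside)) G+v-x)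
              (lookup∘update v τ outside , subst (Face K) (sym (insert-remove τ v τv)) τ-face)
        where
        τv = mono G+v⊑τ v (lookup∘update v G inside)
        x≢v : x ≢ v
        x≢v refl = in≢out (trans (sym (lookup∘update v G inside)) G+v-x)

  module Recursions (q : ℚ) (d : ℕ) (1≤q : 1ℚ ℚ.≤ q) (θ<q : geomℚ q d ℚ.< powℚ q d) where

    0≤q : 0ℚ ℚ.≤ q
    0≤q = ℚₚ.≤-trans 0≤1 1≤q

    simplexBound : ∀ m {K : DecComplex N} {W} → ∣ W ∣ ≡ m → SupportedOn K W → Face K W →
                   CoverWithin K (powℚ q m)
    simplexBound zero    {W = W} ∣W∣ K⊑W W-face =
      pointCover (λ σ f → outside⇒≡⊥ σ λ x → ⊑-outside (K⊑W σ f) (∣∣≡0⇒outside W ∣W∣ x)) ,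
      ℚₚ.≤-refl
    simplexBound (suc m) ∣W∣ K⊑W W-face = simplexWithin m ∣W∣ K⊑W W-face (powℚ-nonNeg q 0≤q (suc m))

    FBound : ℕ → ℕ → Set₁
    FBound N m = ∀ (K : DecComplex N) W → ∣ W ∣ ≡ m → SupportedOn K W → SmallNonFaces d K W →
                 CoverWithin K (powℚ q m)

    -- Splitting at the vertices of a non-face σ one at a time: the deletions are handled by the
    -- induction hypothesis, and the last link has the empty set as a non-face, so it is void.
    nonFaceBound : ∀ r j → (∀ {j′} → j′ < j → FBound N (r + j′)) →
                   ∀ (K : DecComplex N) W σ → ∣ W ∣ ≡ r + j → SupportedOn K W → SmallNonFaces d K W →
                   σ ⊑ W → ¬ Face K σ → ∣ σ ∣ ≡ j → CoverWithin K (powℚ q r ℚ.* geomℚ q j)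
    nonFaceBound r zero IH K W σ ∣W∣ K⊑W small σ⊑W σ∉ ∣σ∣ =
      emptyCover (λ τ f → σ∉ (face-⊑ K (empty⊑ (∣∣≡0⇒outside σ ∣σ∣)) f)) ,
      ℚₚ.≤-reflexive (sym (ℚₚ.*-zeroʳ (powℚ q r)))
    nonFaceBound r (suc j) IH K W σ ∣W∣ K⊑W small σ⊑W σ∉ ∣σ∣ with v , σv ← nonempty⇒member σ ∣σ∣ =
      subst (CoverWithin K) (sym (pow*geom-suc q r j))
        (glueWithin v (IH ℕₚ.≤-refl (deletion v K) (remove W v) ∣W∖v∣
                          (supportedOn-deletion K v K⊑W) (smallNonFaces-deletion K v small))
                      (nonFaceBound r j (λ j′<j → IH (ℕₚ.m≤n⇒m≤1+n j′<j)) (link v K) (remove W v) (remove σ v)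
                          ∣W∖v∣ (supportedOn-link K v K⊑W) (smallNonFaces-link K v small Wv)
                          σ∖v⊑W∖v σ∖v∉ ∣σ∖v∣))
      where
      Wv : lookup W v ≡ inside
      Wv = mono σ⊑W v σv
      ∣W∖v∣ : ∣ remove W v ∣ ≡ r + j
      ∣W∖v∣ = ℕₚ.suc-injective (trans (∣remove∣ W v Wv) (trans ∣W∣ (ℕₚ.+-suc r j)))
      σ∖v⊑W∖v : remove σ v ⊑ remove W v
      σ∖v⊑W∖v = ⊑remove v (⊑-trans (remove⊑ σ v) σ⊑W) (lookup∘update v σ outside)
      σ∖v∉ : ¬ Face (link v K) (remove σ v)
      σ∖v∉ (_ , f) = σ∉ (subst (Face K) (insert-remove σ v σv) f)
      ∣σ∖v∣ : ∣ remove σ v ∣ ≡ j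
      ∣σ∖v∣ = ℕₚ.suc-injective (trans (∣remove∣ σ v σv) ∣σ∣)

    fBound : ∀ m → FBound N m
    fBound {N} = <-rec (FBound N) step
      where
      step : ∀ m → (∀ {m′} → m′ < m → FBound N m′) → FBound N m
      step m IH K W ∣W∣ K⊑W small with face? K W
      ... | yes W-face = simplexBound m ∣W∣ K⊑W W-face
      ... | no W∉ with ρ , ρ⊑W , ρ∉ , ∣ρ∣≤d ← small W ⊑-refl W∉ =
        within-mono (nonFaceBound r ∣ ρ ∣ IH′ K W ρ (trans ∣W∣ (sym r+∣ρ∣≡m)) K⊑W small ρ⊑W ρ∉ refl)
                    (subst (λ i → powℚ q r ℚ.* geomℚ q ∣ ρ ∣ ℚ.≤ powℚ q i) r+∣ρ∣≡m
                           (pow*geom≤pow q 0≤q θ<q r ∣ρ∣≤d))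
        where
        r = m ∸ ∣ ρ ∣
        r+∣ρ∣≡m : r + ∣ ρ ∣ ≡ m
        r+∣ρ∣≡m = ℕₚ.m∸n+n≡m (subst (∣ ρ ∣ ℕ.≤_) ∣W∣ (⊑⇒∣∣≤ ρ W ρ⊑W))
        IH′ : ∀ {j′} → j′ < ∣ ρ ∣ → FBound N (r + j′)
        IH′ j′<∣ρ∣ = IH (subst (r + _ <_) r+∣ρ∣≡m (ℕₚ.+-monoʳ-< r j′<∣ρ∣))

    MBound : ℕ → ℕ → Set₁
    MBound N m = ∀ (K : DecComplex N) W → ∣ W ∣ ≡ m → SupportedOn K W → LargeMaximalFaces d K W →
                 CoverWithin K (powℚ q m)

    -- Splitting at the vertices of W outside a face F: the links are handled by the induction
    -- hypothesis, F survives in every deletion, and the last deletion is the simplex on F.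
    faceBound : ∀ r j → (∀ {j′} → j′ < j → MBound N (suc r + j′)) →
                ∀ (K : DecComplex N) W F → ∣ W ∣ ≡ suc r + j → SupportedOn K W → LargeMaximalFaces d K W →
                Face K F → ∣ F ∣ ≡ suc r → CoverWithin K (powℚ q (suc r) ℚ.* geomℚ q j)
    faceBound r zero IH K W F ∣W∣ K⊑W large F-face ∣F∣ =
      simplexWithin r ∣W∣′ K⊑W (face-⊑ K F⊒W F-face) (ℚₚ.≤-reflexive (sym (ℚₚ.*-zeroʳ (powℚ q (suc r)))))
      where
      ∣W∣′ : ∣ W ∣ ≡ suc r
      ∣W∣′ = trans ∣W∣ (ℕₚ.+-identityʳ (suc r))
      F⊒W : W ⊑ F
      F⊒W = ⊑∧∣∣≡⇒⊒ F W (K⊑W F F-face) (trans ∣F∣ (sym ∣W∣′))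
    faceBound r (suc j) IH K W F ∣W∣ K⊑W large F-face ∣F∣
      with v , Wv , Fv ← ⊑∧∣∣<⇒missing F W (K⊑W F F-face)
                           (subst₂ _<_ (sym ∣F∣) (sym ∣W∣) (ℕₚ.m<m+n (suc r) (s≤s z≤n))) =
      subst (CoverWithin K) (trans (ℚₚ.+-comm (powℚ q (suc r) ℚ.* geomℚ q j) (powℚ q (suc r + j)))
                                   (sym (pow*geom-suc q (suc r) j)))
        (glueWithin v (faceBound r j (λ j′<j → IH (ℕₚ.m≤n⇒m≤1+n j′<j)) (deletion v K) (remove W v) F ∣W∖v∣
                          (supportedOn-deletion K v K⊑W) (largeMaximalFaces-deletion K {W} v Wv large) (F-face , Fv) ∣F∣)
                      (IH ℕₚ.≤-refl (link v K) (remove W v) ∣W∖v∣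
                          (supportedOn-link K v K⊑W) (largeMaximalFaces-link K {W} v Wv large)))
      where
      ∣W∖v∣ : ∣ remove W v ∣ ≡ suc r + j
      ∣W∖v∣ = ℕₚ.suc-injective (trans (∣remove∣ W v Wv) (trans ∣W∣ (ℕₚ.+-suc (suc r) j)))

    mBound : ∀ m → MBound N m
    mBound {N} = <-rec (MBound N) step
      where
      step : ∀ m → (∀ {m′} → m′ < m → MBound N m′) → MBound N m
      step m IH K W ∣W∣ K⊑W large with face? K ⊥
      ... | no ⊥∉ = emptyCover (λ τ f → ⊥∉ (face-⊑ K (empty⊑ lookup-⊥) f)) , powℚ-nonNeg q 0≤q m
      ... | yes ⊥-face with maximalExtension K ⊥ ⊥-face
      ...   | H , _ , H-max with ∣ H ∣ in ∣H∣
      ...     | zero = pointCover only-⊥ , powℚ-≥1 q 1≤q m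
        where
        only-⊥ : ∀ σ → Face K σ → σ ≡ ⊥
        only-⊥ σ f = outside⇒≡⊥ σ λ x → ≢inside λ σx →
          proj₂ H-max σ (empty⊑ (∣∣≡0⇒outside H ∣H∣) , x , σx , ∣∣≡0⇒outside H ∣H∣ x) f
      ...     | suc k = within-mono (faceBound k j IH′ K W H (trans ∣W∣ (sym k+j≡m)) K⊑W large (proj₁ H-max) ∣H∣)
                                    (subst (λ i → powℚ q (suc k) ℚ.* geomℚ q j ℚ.≤ powℚ q i) k+j≡m
                                           (pow*geom≤pow q 0≤q θ<q (suc k) j≤d))
        where
        j = m ∸ suc k
        k+j≡m : suc k + j ≡ m
        k+j≡m = ℕₚ.m+[n∸m]≡n (subst₂ ℕ._≤_ ∣H∣ ∣W∣ (⊑⇒∣∣≤ H W (K⊑W H (proj₁ H-max))))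
        j≤d : j ℕ.≤ d
        j≤d = ℕₚ.m≤n+o⇒m∸n≤o m (suc k) (subst₂ ℕ._≤_ ∣W∣ (cong (_+ d) ∣H∣) (large H H-max))
        IH′ : ∀ {j′} → j′ < j → MBound N (suc k + j′)
        IH′ j′<j = IH (subst (suc k + _ <_) k+j≡m (ℕₚ.+-monoʳ-< (suc k) j′<j))

module CountingBySize where

  open import Data.Nat as ℕ using (zero; suc; s≤s)
  import Data.Nat.Properties as ℕₚ
  open import Data.Bool using (if_then_else_)
  open import Data.Fin using (Fin; zero; suc; toℕ; fromℕ<)
  open import Data.Fin.Properties using (toℕ-injective; toℕ-fromℕ<)
  open import Data.Fin.Subset using (Subset; ∣_∣)
  open import Data.Fin.Subset.Properties using (∣p∣≤n)
  open import Data.List using (List; []; _∷_; length; filter)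
  open import Relation.Nullary using (Dec; does; yes; no)
  open import Relation.Nullary.Decidable using (dec-true; dec-false)
  open import Relation.Unary using (Decidable)
  open import Relation.Binary.PropositionalEquality
  open FinSums ℕₚ.+-0-commutativeMonoid

  indicator : ∀ {P : Set} → Dec P → ℕ
  indicator P? = if does P? then 1 else 0

  length-filter-∷ : ∀ {A : Set} {P : A → Set} (P? : Decidable P) x xs →
                    length (filter P? (x ∷ xs)) ≡ indicator (P? x) ℕ.+ length (filter P? xs)
  length-filter-∷ P? x xs with P? x
  ... | yes _ = refl
  ... | no  _ = refl

  hasSize? : ∀ {n} s (σ : Subset n) → Dec (∣ σ ∣ ≡ s)
  hasSize? s σ = ∣ σ ∣ ℕ.≟ s

  size-indicator-sum : ∀ {n} (σ : Subset n) → sum (λ (s : Fin (suc n)) → indicator (hasSize? (toℕ s) σ)) ≡ 1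
  size-indicator-sum {n} σ = trans (sum-single _ s₀ off-s₀) at-s₀
    where
    s₀ : Fin (suc n)
    s₀ = fromℕ< (s≤s (∣p∣≤n σ))
    at-s₀ : indicator (hasSize? (toℕ s₀) σ) ≡ 1
    at-s₀ = cong (λ b → if b then 1 else 0) (dec-true (hasSize? (toℕ s₀) σ) (sym (toℕ-fromℕ< _)))
    off-s₀ : ∀ s → s ≢ s₀ → indicator (hasSize? (toℕ s) σ) ≡ 0
    off-s₀ s s≢s₀ = cong (λ b → if b then 1 else 0) (dec-false (hasSize? (toℕ s) σ)
                      λ ∣σ∣≡s → s≢s₀ (toℕ-injective (trans (sym ∣σ∣≡s) (sym (toℕ-fromℕ< _)))))

  count-by-size : ∀ {n} (xs : List (Subset n)) →
                  sum (λ (s : Fin (suc n)) → length (filter (hasSize? (toℕ s)) xs)) ≡ length xs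
  count-by-size {n} []       = sum-zero {suc n} λ _ → refl
  count-by-size {n} (x ∷ xs) = begin
    Σₛ (λ s → length (filter (P s) (x ∷ xs)))
      ≡⟨ sum-cong-≗ (λ s → length-filter-∷ (P s) x xs) ⟩
    Σₛ (λ s → indicator (P s x) ℕ.+ length (filter (P s) xs))
      ≡⟨ ∑-distrib-+ (λ s → indicator (P s x)) (λ s → length (filter (P s) xs)) ⟩
    Σₛ (λ s → indicator (P s x)) ℕ.+ Σₛ (λ s → length (filter (P s) xs))
      ≡⟨ cong₂ ℕ._+_ (size-indicator-sum x) (count-by-size xs) ⟩
    suc (length xs)
      ∎
    where
    open ≡-Reasoning
    Σₛ : (Fin (suc n) → ℕ) → ℕ
    Σₛ = sum
    P : (s : Fin (suc n)) (σ : Subset n) → Dec (∣ σ ∣ ≡ toℕ s)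
    P s = hasSize? (toℕ s)

  sum-mono : ∀ {m} {f g : Fin m → ℕ} → (∀ i → f i ≤ g i) → sum f ≤ sum g
  sum-mono {zero}  f≤g = ℕ.z≤n
  sum-mono {suc m} f≤g = ℕₚ.+-mono-≤ (f≤g zero) (sum-mono (λ i → f≤g (suc i)))

module MorseInequality {c ℓ : Level} (𝕜 : Field c ℓ) where

  open Field 𝕜 hiding (zero)
  open Homology 𝕜
  open FinSums +-commutativeMonoid
  open import Algebra.Properties.Semiring.Sum semiring using (*-distribˡ-sum; *-distribʳ-sum)
  open import Algebra.Properties.Ring ring using (-‿distribˡ-*; -‿distribʳ-*; -‿involutive)
  open import Data.Nat as ℕ using (zero; suc)
  import Data.Nat.Properties as ℕₚ
  open import Data.Fin using (Fin; zero; suc; punchIn; splitAt; _↑ˡ_; _↑ʳ_)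
  open import Data.Fin.Properties using (join-splitAt)
  open import Data.Vec.Functional using (insertAt; _++_)
  open import Data.Vec.Functional.Properties using (insertAt-lookup; insertAt-punchIn; lookup-++ˡ; lookup-++ʳ)
  open import Data.Vec using (lookup)
  open import Data.Vec.Properties using (lookup∘update; lookup∘update′)
  open import Data.Fin using (toℕ)
  open import Data.Fin.Subset using (Subset; inside; outside; ∣_∣)
  open import Data.List as List using (List; []; _∷_)
  open import Data.List.Properties using (length-++; length-map)
  open import Data.List.Membership.Propositional using (_∈_; _∉_)
  open import Data.List.Membership.Propositional.Properties
    using (∈-lookup; ∈-map⁺; ∈-map⁻; ∈-++⁺ˡ; ∈-++⁺ʳ; ∈-filter⁺)
  open import Data.List.Relation.Unary.All as All using (All; _∷_)
  import Data.List.Relation.Unary.All.Properties as Allₚ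
  open import Data.List.Relation.Unary.AllPairs as AllPairs using (AllPairs; _∷_)
  import Data.List.Relation.Unary.AllPairs.Properties as AllPairsₚ
  open import Data.List.Relation.Unary.Any using (here; there)
  open import Data.Product using (Σ; _,_; proj₁; proj₂)
  open import Data.Sum using (_⊎_; inj₁; inj₂)
  open import Data.Empty using (⊥-elim)
  open import Function using (_∘_)
  open import Level using (_⊔_)
  open import Relation.Nullary using (¬_; Dec; yes; no)
  open import Relation.Nullary.Decidable using (decidable-stable)
  import Relation.Binary.PropositionalEquality as ≡
  open ≡ using (_≡_; _≢_)
  open import Relation.Binary.Reasoning.Setoid setoid
  open import Algebra.Properties.CommutativeSemigroup *-commutativeSemigroup using (x∙yz≈y∙xz)
  open DoubleNegation
  open Subsets
  open MorseCovers
  open CountingBySize using (hasSize?; count-by-size; sum-mono)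

  sumFin≡sum : ∀ {m} (f : Fin m → Carrier) → sumFin f ≡ sum f
  sumFin≡sum = foldr-allFinL≡sum

  combination : ∀ {n m} → (Fin m → Carrier) → (Fin m → Vect n) → Vect n
  combination cs vs σ = sum λ j → cs j * vs j σ

  independent-intro : ∀ {n m} {vs : Fin m → Vect n} →
                      (∀ cs → (∀ σ → combination cs vs σ ≈ 0#) → ∀ j → cs j ≈ 0#) → Independent vs
  independent-intro {vs = vs} ind cs h =
    ind cs λ σ → trans (reflexive (≡.sym (sumFin≡sum (λ j → cs j * vs j σ)))) (h σ)

  independent-elim : ∀ {n m} {vs : Fin m → Vect n} → Independent vs →
                     ∀ cs → (∀ σ → combination cs vs σ ≈ 0#) → ∀ j → cs j ≈ 0#
  independent-elim {vs = vs} ind cs h =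
    ind cs λ σ → trans (reflexive (sumFin≡sum (λ j → cs j * vs j σ))) (h σ)

  IsUnit : Carrier → Set (c ⊔ ℓ)
  IsUnit u = Σ Carrier λ u⁻¹ → u * u⁻¹ ≈ 1#

  unit-cancel : ∀ {x u} → IsUnit u → x * u ≈ 0# → x ≈ 0#
  unit-cancel {x} {u} (u⁻¹ , uu⁻¹≈1) xu≈0 = begin
    x              ≈⟨ sym (*-identityʳ x) ⟩
    x * 1#         ≈⟨ *-congˡ (sym uu⁻¹≈1) ⟩
    x * (u * u⁻¹)  ≈⟨ sym (*-assoc x u u⁻¹) ⟩
    (x * u) * u⁻¹  ≈⟨ *-congʳ xu≈0 ⟩
    0# * u⁻¹       ≈⟨ zeroˡ u⁻¹ ⟩
    0#             ∎

  signPow-unit : ∀ k → IsUnit (signPow k)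
  signPow-unit k = signPow k , signPow² k
    where
    signPow² : ∀ k → signPow k * signPow k ≈ 1#
    signPow² zero    = *-identityˡ 1#
    signPow² (suc k) = begin
      - signPow k * - signPow k      ≈⟨ sym (-‿distribˡ-* (signPow k) (- signPow k)) ⟩
      - (signPow k * - signPow k)    ≈⟨ -‿cong (sym (-‿distribʳ-* (signPow k) (signPow k))) ⟩
      - - (signPow k * signPow k)    ≈⟨ -‿involutive (signPow k * signPow k) ⟩
      signPow k * signPow k          ≈⟨ signPow² k ⟩
      1#                             ∎

  triangular⇒independent : ∀ {n} {A : Set} (w : A → Vect n) (t : A → Subset n) as →
                           All (λ a → IsUnit (w a (t a))) as → AllPairs (λ a a′ → w a′ (t a) ≈ 0#) as →
                           Independent (w ∘ List.lookup as)
  triangular⇒independent w t []       _              _              =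
    independent-intro {vs = w ∘ List.lookup []} λ _ _ ()
  triangular⇒independent w t (a ∷ as) (unit ∷ units) (below ∷ rest) = independent-intro all-zero
    where
    c₀≈0 : ∀ cs → (∀ σ → combination cs (w ∘ List.lookup (a ∷ as)) σ ≈ 0#) → cs zero ≈ 0#
    c₀≈0 cs h = unit-cancel unit (begin
      cs zero * w a (t a)
        ≈⟨ sym (+-identityʳ _) ⟩
      cs zero * w a (t a) + 0#
        ≈⟨ +-congˡ (sym (sum-zero λ j → trans (*-congˡ (All.lookup below (∈-lookup j))) (zeroʳ _))) ⟩
      combination cs (w ∘ List.lookup (a ∷ as)) (t a)
        ≈⟨ h (t a) ⟩
      0#
        ∎)
    all-zero : ∀ cs → (∀ σ → combination cs (w ∘ List.lookup (a ∷ as)) σ ≈ 0#) → ∀ j → cs j ≈ 0#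
    all-zero cs h zero    = c₀≈0 cs h
    all-zero cs h (suc j) = independent-elim (triangular⇒independent w t as units rest) (cs ∘ suc)
      (λ σ → trans (sym (+-identityˡ _)) (trans (+-congʳ (sym (trans (*-congʳ (c₀≈0 cs h)) (zeroˡ _)))) (h σ))) j

  SupportedIn : ∀ {n k} → (Fin k → Vect n) → List (Subset n) → Set ℓ
  SupportedIn vs S = ∀ j σ → σ ∉ S → vs j σ ≈ 0#

  combination-shift : ∀ {m} (cs A μ : Fin m → Carrier) B →
                      sum (λ i → cs i * (A i + μ i * B)) ≈ sum (λ i → cs i * μ i) * B + sum (λ i → cs i * A i)
  combination-shift cs A μ B = begin
    sum (λ i → cs i * (A i + μ i * B))
      ≈⟨ sum-cong-≋ (λ i → trans (distribˡ (cs i) (A i) _) (+-congˡ (sym (*-assoc (cs i) (μ i) B)))) ⟩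
    sum (λ i → cs i * A i + (cs i * μ i) * B)
      ≈⟨ ∑-distrib-+ (λ i → cs i * A i) (λ i → (cs i * μ i) * B) ⟩
    sum (λ i → cs i * A i) + sum (λ i → (cs i * μ i) * B)
      ≈⟨ +-congˡ (sym (*-distribʳ-sum B (λ i → cs i * μ i))) ⟩
    sum (λ i → cs i * A i) + sum (λ i → cs i * μ i) * B
      ≈⟨ +-comm _ _ ⟩
    sum (λ i → cs i * μ i) * B + sum (λ i → cs i * A i)
      ∎

  -- Gaussian elimination of the coordinate x using vs j₀, which does not vanish there.
  module Exchange {n k} (x : Subset n) (S : List (Subset n)) (vs : Fin (suc k) → Vect n)
                  (supp : SupportedIn vs (x ∷ S)) (ind : Independent vs)
                  (j₀ : Fin (suc k)) (nz : ¬ vs j₀ x ≈ 0#) where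

    a⁻¹ : Carrier
    a⁻¹ = proj₁ (inverse (vs j₀ x) nz)

    a⁻¹a≈1 : a⁻¹ * vs j₀ x ≈ 1#
    a⁻¹a≈1 = trans (*-comm a⁻¹ (vs j₀ x)) (proj₂ (inverse (vs j₀ x) nz))

    μ : Fin k → Carrier
    μ i = - (vs (punchIn j₀ i) x * a⁻¹)

    ws : Fin k → Vect n
    ws i σ = vs (punchIn j₀ i) σ + μ i * vs j₀ σ

    ws-supported : SupportedIn ws S
    ws-supported i σ σ∉S with σ ≟ˢ x
    ... | yes ≡.refl = begin
      b + - (b * a⁻¹) * vs j₀ x
        ≈⟨ +-congˡ (sym (-‿distribˡ-* (b * a⁻¹) (vs j₀ x))) ⟩
      b + - ((b * a⁻¹) * vs j₀ x)
        ≈⟨ +-congˡ (-‿cong (trans (*-assoc b a⁻¹ (vs j₀ x)) (trans (*-congˡ a⁻¹a≈1) (*-identityʳ b)))) ⟩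
      b + - b
        ≈⟨ -‿inverseʳ b ⟩
      0#
        ∎
      where b = vs (punchIn j₀ i) x
    ... | no σ≢x = begin
      vs (punchIn j₀ i) σ + μ i * vs j₀ σ
        ≈⟨ +-cong (supp (punchIn j₀ i) σ σ∉) (*-congˡ (supp j₀ σ σ∉)) ⟩
      0# + μ i * 0#
        ≈⟨ trans (+-identityˡ _) (zeroʳ (μ i)) ⟩
      0#
        ∎
      where
      σ∉ : σ ∉ x ∷ S
      σ∉ (here σ≡x) = σ≢x σ≡x
      σ∉ (there σ∈S) = σ∉S σ∈S

    ws-independent : Independent ws
    ws-independent = independent-intro λ cs′ h i →
      trans (reflexive (≡.sym (insertAt-punchIn cs′ j₀ (λ₀ cs′) i)))
            (independent-elim ind (insertAt cs′ j₀ (λ₀ cs′)) (λ σ → trans (lift cs′ σ) (h σ))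
                              (punchIn j₀ i))
      where
      λ₀ : (Fin k → Carrier) → Carrier
      λ₀ cs′ = sum λ i → cs′ i * μ i
      lift : ∀ cs′ σ → combination (insertAt cs′ j₀ (λ₀ cs′)) vs σ ≈ combination cs′ ws σ
      lift cs′ σ = begin
        combination cs vs σ
          ≈⟨ sum-remove {i = j₀} (λ j → cs j * vs j σ) ⟩
        cs j₀ * vs j₀ σ + sum (λ i → cs (punchIn j₀ i) * vs (punchIn j₀ i) σ)
          ≡⟨ ≡.cong₂ (λ a s → a * vs j₀ σ + s)
                     (insertAt-lookup cs′ j₀ (λ₀ cs′))
                     (sum-cong-≗ λ i → ≡.cong (_* vs (punchIn j₀ i) σ) (insertAt-punchIn cs′ j₀ (λ₀ cs′) i)) ⟩
        λ₀ cs′ * vs j₀ σ + sum (λ i → cs′ i * vs (punchIn j₀ i) σ)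
          ≈⟨ sym (combination-shift cs′ (λ i → vs (punchIn j₀ i) σ) μ (vs j₀ σ)) ⟩
        combination cs′ ws σ
          ∎
        where cs = insertAt cs′ j₀ (λ₀ cs′)

  -- Steinitz exchange. Since k ≤ |S| is decidable, it may be proved by cases on whether all vs j vanish at x.
  independent⇒≤length : ∀ {n} (S : List (Subset n)) {k} (vs : Fin k → Vect n) →
                         SupportedIn vs S → Independent vs → k ℕ.≤ List.length S
  independent⇒≤length [] {zero}  vs supp ind = ℕ.z≤n
  independent⇒≤length [] {suc k} vs supp ind = ⊥-elim (0≉1 (sym (independent-elim ind (λ _ → 1#) vanish zero)))
    where
    vanish : ∀ σ → combination (λ _ → 1#) vs σ ≈ 0#
    vanish σ = sum-zero λ j → trans (*-congˡ (supp j σ λ ())) (zeroʳ 1#)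
  independent⇒≤length (x ∷ S) {k} vs supp ind =
    decidable-stable (k ℕ.≤? suc (List.length S)) λ k≰ →
      ¬¬-all⊎counterexample k (λ j → vs j x ≈ 0#) (k≰ ∘ by-cases)
    where
    by-cases : (∀ j → vs j x ≈ 0#) ⊎ Σ (Fin k) (λ j → ¬ vs j x ≈ 0#) → k ℕ.≤ suc (List.length S)
    by-cases (inj₁ vanish-at-x) = ℕₚ.m≤n⇒m≤1+n (independent⇒≤length S vs supported-in-S ind)
      where
      supported-in-S : SupportedIn vs S
      supported-in-S j σ σ∉S with σ ≟ˢ x
      ... | yes ≡.refl = vanish-at-x j
      ... | no σ≢x = supp j σ λ { (here σ≡x) → σ≢x σ≡x ; (there σ∈S) → σ∉S σ∈S }
    by-cases (inj₂ (j₀ , nz)) = eliminate vs supp ind j₀ nz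
      where
      eliminate : ∀ {k} (vs : Fin k → Vect _) → SupportedIn vs (x ∷ S) → Independent vs → (j₀ : Fin k) →
                  ¬ vs j₀ x ≈ 0# → k ℕ.≤ suc (List.length S)
      eliminate {suc k} vs supp ind j₀ nz = ℕ.s≤s (independent⇒≤length S ws ws-supported ws-independent)
        where open Exchange x S vs supp ind j₀ nz

  coface : ∀ {n} → Vect n → Subset n → Fin n → Carrier
  coface f τ v with lookup τ v
  ... | inside  = 0#
  ... | outside = signPow (countBefore τ v) * f (insert τ v)

  -- ∂ sums a function local to its definition; unification recovers it for comparison with coface.
  summand : ∀ {n} {x : Carrier} {g : Fin n → Carrier} → x ≡ sumL g (allFinL n) → Fin n → Carrier
  summand {g = g} _ = g

  ∂≡sum-coface : ∀ {n} (f : Vect n) τ → ∂ f τ ≡ sum (coface f τ)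
  ∂≡sum-coface {n} f τ = ≡.trans (sumFin≡sum (summand {n} {x = ∂ f τ} ≡.refl)) (sum-cong-≗ same)
    where
    same : ∀ v → summand {n} {x = ∂ f τ} ≡.refl v ≡ coface f τ v
    same v with lookup τ v
    ... | inside  = ≡.refl
    ... | outside = ≡.refl

  ∂-zero : ∀ {n} {f : Vect n} τ → (∀ σ → f σ ≈ 0#) → ∂ f τ ≈ 0#
  ∂-zero {f = f} τ f≈0 = trans (reflexive (∂≡sum-coface f τ)) (sum-zero coface-zero)
    where
    coface-zero : ∀ v → coface f τ v ≈ 0#
    coface-zero v with lookup τ v
    ... | inside  = refl
    ... | outside = trans (*-congˡ (f≈0 _)) (zeroʳ _)

  ∂-linear : ∀ {n m} (cs : Fin m → Carrier) (ws : Fin m → Vect n) τ →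
             ∂ (combination cs ws) τ ≈ combination cs (λ j → ∂ (ws j)) τ
  ∂-linear cs ws τ = begin
    ∂ (combination cs ws) τ
      ≡⟨ ∂≡sum-coface (combination cs ws) τ ⟩
    sum (coface (combination cs ws) τ)
      ≈⟨ sum-cong-≋ coface-linear ⟩
    sum (λ v → sum λ j → cs j * coface (ws j) τ v)
      ≈⟨ ∑-comm (λ v j → cs j * coface (ws j) τ v) ⟩
    sum (λ j → sum λ v → cs j * coface (ws j) τ v)
      ≈⟨ sum-cong-≋ (λ j → sym (*-distribˡ-sum (cs j) (coface (ws j) τ))) ⟩
    sum (λ j → cs j * sum (coface (ws j) τ))
      ≡⟨ sum-cong-≗ (λ j → ≡.cong (cs j *_) (≡.sym (∂≡sum-coface (ws j) τ))) ⟩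
    combination cs (λ j → ∂ (ws j)) τ
      ∎
    where
    coface-linear : ∀ v → coface (combination cs ws) τ v ≈ sum λ j → cs j * coface (ws j) τ v
    coface-linear v with lookup τ v
    ... | inside  = sym (sum-zero λ j → zeroʳ (cs j))
    ... | outside = trans (*-distribˡ-sum s (λ j → cs j * ws j (insert τ v)))
                          (sum-cong-≋ λ j → x∙yz≈y∙xz s (cs j) (ws j (insert τ v)))
      where s = signPow (countBefore τ v)

  δ : ∀ {n} → Subset n → Vect n
  δ σ ρ with ρ ≟ˢ σ
  ... | yes _ = 1#
  ... | no  _ = 0#

  δ-same : ∀ {n} (σ : Subset n) → δ σ σ ≈ 1#
  δ-same σ with σ ≟ˢ σ
  ... | yes _  = refl
  ... | no σ≢σ = ⊥-elim (σ≢σ ≡.refl)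

  δ-other : ∀ {n} {σ ρ : Subset n} → ρ ≢ σ → δ σ ρ ≈ 0#
  δ-other {σ = σ} {ρ} ρ≢σ with ρ ≟ˢ σ
  ... | yes ρ≡σ = ⊥-elim (ρ≢σ ρ≡σ)
  ... | no  _   = refl

  ∂δ-nonfacet : ∀ {n} {ρ σ : Subset n} → ¬ ρ ⋖ σ → ∂ (δ σ) ρ ≈ 0#
  ∂δ-nonfacet {ρ = ρ} {σ} ρ⋪σ = trans (reflexive (∂≡sum-coface (δ σ) ρ)) (sum-zero vanish)
    where
    vanish : ∀ v → coface (δ σ) ρ v ≈ 0#
    vanish v with lookup ρ v in ρv
    ... | inside  = refl
    ... | outside = trans (*-congˡ (δ-other ρ+v≢σ)) (zeroʳ _)
      where
      ρ+v≢σ : insert ρ v ≢ σ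
      ρ+v≢σ ≡.refl = ρ⋪σ (v , lookup∘update v ρ inside , ≡.sym (remove-insert ρ v ρv))

  ∂δ-facet-unit : ∀ {n} (σ : Subset n) u → lookup σ u ≡ inside → IsUnit (∂ (δ σ) (remove σ u))
  ∂δ-facet-unit σ u σu = proj₁ (signPow-unit k) , trans (*-congʳ ∂δ≈sign) (proj₂ (signPow-unit k))
    where
    k = countBefore (remove σ u) u
    at-u : coface (δ σ) (remove σ u) u ≈ signPow k
    at-u with lookup (remove σ u) u in σ∖u-u
    ... | inside  = ⊥-elim (in≢out (≡.trans (≡.sym σ∖u-u) (lookup∘update u σ outside)))
    ... | outside = trans (*-congˡ (trans (reflexive (≡.cong (δ σ) (insert-remove σ u σu))) (δ-same σ)))
                          (*-identityʳ (signPow k))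
    off-u : ∀ v → v ≢ u → coface (δ σ) (remove σ u) v ≈ 0#
    off-u v v≢u with lookup (remove σ u) v
    ... | inside  = refl
    ... | outside = trans (*-congˡ (δ-other σ∖u+v≢σ)) (zeroʳ _)
      where
      σ∖u+v≢σ : insert (remove σ u) v ≢ σ
      σ∖u+v≢σ σ∖u+v≡σ = in≢out (≡.trans (≡.sym σu) (≡.trans (≡.cong (λ τ → lookup τ u) (≡.sym σ∖u+v≡σ))
        (≡.trans (lookup∘update′ (v≢u ∘ ≡.sym) (remove σ u) inside) (lookup∘update u σ outside))))
    ∂δ≈sign : ∂ (δ σ) (remove σ u) ≈ signPow k
    ∂δ≈sign = trans (reflexive (∂≡sum-coface (δ σ) (remove σ u))) (trans (sum-single _ u off-u) at-u)

  ++-independent : ∀ {n a b} (zs : Fin a → Vect n) (es : Fin b → Vect n) → Independent zs →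
                   (∀ i τ → ∂ (zs i) τ ≈ 0#) → Independent (λ i → ∂ (es i)) → Independent (zs ++ es)
  ++-independent {n} {a} {b} zs es zs-ind ∂zs≈0 ∂es-ind = independent-intro all-zero
    where
    split : ∀ (cs : Fin (a ℕ.+ b) → Carrier) (F : Vect n → Carrier) →
            sum (λ j → cs j * F ((zs ++ es) j)) ≈
            sum (λ i → cs (i ↑ˡ b) * F (zs i)) + sum (λ i → cs (a ↑ʳ i) * F (es i))
    split cs F = trans (sum-split {a} {b} (λ j → cs j * F ((zs ++ es) j)))
      (+-cong (reflexive (sum-cong-≗ λ i → ≡.cong (λ v → cs (i ↑ˡ b) * F v) (lookup-++ˡ zs es i)))
              (reflexive (sum-cong-≗ λ i → ≡.cong (λ v → cs (a ↑ʳ i) * F v) (lookup-++ʳ zs es i))))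

    right-zero : ∀ cs → (∀ σ → combination cs (zs ++ es) σ ≈ 0#) → ∀ i → cs (a ↑ʳ i) ≈ 0#
    right-zero cs h = independent-elim ∂es-ind (cs ∘ (a ↑ʳ_)) λ τ → begin
      combination (cs ∘ (a ↑ʳ_)) (λ i → ∂ (es i)) τ
        ≈⟨ sym (+-identityˡ _) ⟩
      0# + combination (cs ∘ (a ↑ʳ_)) (λ i → ∂ (es i)) τ
        ≈⟨ +-congʳ (sym (sum-zero λ i → trans (*-congˡ (∂zs≈0 i τ)) (zeroʳ _))) ⟩
      sum (λ i → cs (i ↑ˡ b) * ∂ (zs i) τ) + sum (λ i → cs (a ↑ʳ i) * ∂ (es i) τ)
        ≈⟨ sym (split cs (λ v → ∂ v τ)) ⟩
      combination cs (λ j → ∂ ((zs ++ es) j)) τ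
        ≈⟨ sym (∂-linear cs (zs ++ es) τ) ⟩
      ∂ (combination cs (zs ++ es)) τ
        ≈⟨ ∂-zero τ h ⟩
      0#
        ∎

    left-zero : ∀ cs → (∀ σ → combination cs (zs ++ es) σ ≈ 0#) → ∀ i → cs (i ↑ˡ b) ≈ 0#
    left-zero cs h = independent-elim zs-ind (cs ∘ (_↑ˡ b)) λ σ → begin
      combination (cs ∘ (_↑ˡ b)) zs σ
        ≈⟨ sym (+-identityʳ _) ⟩
      combination (cs ∘ (_↑ˡ b)) zs σ + 0#
        ≈⟨ +-congˡ (sym (sum-zero λ i → trans (*-congʳ (right-zero cs h i)) (zeroˡ _))) ⟩
      sum (λ i → cs (i ↑ˡ b) * zs i σ) + sum (λ i → cs (a ↑ʳ i) * es i σ)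
        ≈⟨ sym (split cs (λ v → v σ)) ⟩
      combination cs (zs ++ es) σ
        ≈⟨ h σ ⟩
      0#
        ∎

    all-zero : ∀ cs → (∀ σ → combination cs (zs ++ es) σ ≈ 0#) → ∀ j → cs j ≈ 0#
    all-zero cs h j with splitAt a j | join-splitAt a b j
    ... | inj₁ i | ≡.refl = left-zero cs h i
    ... | inj₂ i | ≡.refl = right-zero cs h i

  ++-supported : ∀ {n a b} {zs : Fin a → Vect n} {es : Fin b → Vect n} {S} →
                 SupportedIn zs S → SupportedIn es S → SupportedIn (zs ++ es) S
  ++-supported {a = a} zs-supp es-supp j σ σ∉S with splitAt a j
  ... | inj₁ i = zs-supp i σ σ∉S
  ... | inj₂ i = es-supp i σ σ∉S

  module _ {n} (K : SimplicialComplex n) (face? : ∀ σ → Dec (IsFace K σ))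
           (M : MorseCover (toDecComplex K face?)) where

    pairsOfSize : ℕ → List (MatchedPair (toDecComplex K face?))
    pairsOfSize s = List.filter (λ p → ∣ top p ∣ ℕ.≟ s) (pairs M)

    criticalOfSize : ℕ → List (Subset n)
    criticalOfSize s = List.filter (hasSize? s) (critical M)

    D : ℕ → ℕ
    D s = List.length (pairsOfSize s)

    tops : ∀ s → Fin (D s) → Subset n
    tops s j = top (List.lookup (pairsOfSize s) j)

    tops-face : ∀ s j → IsFace K (tops s j)
    tops-face s j = top-face (List.lookup (pairsOfSize s) j)

    ∣tops∣ : ∀ s j → ∣ tops s j ∣ ≡ s
    ∣tops∣ s j = All.lookup (Allₚ.all-filter (λ p → ∣ top p ∣ ℕ.≟ s) (pairs M)) (∈-lookup j)

    δ-chain : ∀ {s σ} → IsFace K σ → ∣ σ ∣ ≡ s → Chain K s (δ σ)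
    δ-chain {σ = σ} σ-face ∣σ∣ ρ ρ∉ = δ-other {σ = σ} {ρ} λ { ≡.refl → ρ∉ (σ-face , ∣σ∣) }

    ∂δ-chain : ∀ {s σ} → IsFace K σ → ∣ σ ∣ ≡ suc s → Chain K s (∂ (δ σ))
    ∂δ-chain {σ = σ} σ-face ∣σ∣ ρ ρ∉ with ρ ⋖? σ
    ... | yes (u , σu , ≡.refl) = ⊥-elim (ρ∉ (down-closed K σ (remove σ u) (⊑⇒⊆ (remove⊑ σ u)) σ-face ,
                                              ℕₚ.suc-injective (≡.trans (∣remove∣ σ u σu) ∣σ∣)))
    ... | no  ρ⋪σ             = ∂δ-nonfacet ρ⋪σ

    ∂δ-tops-independent : ∀ s → Independent (λ j → ∂ (δ (tops s j)))
    ∂δ-tops-independent s = triangular⇒independent (λ p → ∂ (δ (top p))) bot (pairsOfSize s)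
      (All.universal (λ p → ∂δ-facet-unit (top p) (pivot p) (pivot∈ p)) _)
      (AllPairs.map ∂δ-nonfacet (AllPairsₚ.filter⁺ _ (triangular M)))

    boundaries-bound : ∀ s b → IsDim (Boundary K s) b → D (suc s) ℕ.≤ b
    boundaries-bound s b (_ , maximal) = maximal (D (suc s)) (λ j → ∂ (δ (tops (suc s) j))) is-boundary
                                                 (∂δ-tops-independent (suc s))
      where
      is-boundary : ∀ j → Boundary K s (∂ (δ (tops (suc s) j)))
      is-boundary j = ∂δ-chain (tops-face (suc s) j) (∣tops∣ (suc s) j) ,
                      δ (tops (suc s) j) , δ-chain (tops-face (suc s) j) (∣tops∣ (suc s) j) , λ τ → refl

    bots-or-critical : ℕ → List (Subset n)
    bots-or-critical s = criticalOfSize s List.++ List.map bot (pairsOfSize (suc s))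

    spanning : ℕ → List (Subset n)
    spanning s = bots-or-critical s List.++ List.map top (pairsOfSize s)

    ∣spanning∣ : ∀ s → List.length (spanning s) ≡ (List.length (criticalOfSize s) ℕ.+ D (suc s)) ℕ.+ D s
    ∣spanning∣ s =
      ≡.trans (length-++ (bots-or-critical s)) (≡.cong₂ ℕ._+_ ∣bots-or-critical∣ (length-map top (pairsOfSize s)))
      where
      ∣bots-or-critical∣ = ≡.trans (length-++ (criticalOfSize s))
                                   (≡.cong (List.length (criticalOfSize s) ℕ.+_) (length-map bot (pairsOfSize (suc s))))

    face∈spanning : ∀ {s σ} → IsFace K σ → ∣ σ ∣ ≡ s → σ ∈ spanning s
    face∈spanning {s} {σ} σ-face ∣σ∣ with covers M σ σ-face
    ... | inj₁ σ∈C = ∈-++⁺ˡ (∈-++⁺ˡ (∈-filter⁺ (hasSize? s) σ∈C ∣σ∣))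
    ... | inj₂ (inj₁ σ∈tops) with p , p∈ , ≡.refl ← ∈-map⁻ top σ∈tops =
      ∈-++⁺ʳ (bots-or-critical s) (∈-map⁺ top (∈-filter⁺ (λ p → ∣ top p ∣ ℕ.≟ s) p∈ ∣σ∣))
    ... | inj₂ (inj₂ σ∈bots) with p , p∈ , ≡.refl ← ∈-map⁻ bot σ∈bots =
      ∈-++⁺ˡ (∈-++⁺ʳ (criticalOfSize s) (∈-map⁺ bot (∈-filter⁺ (λ p → ∣ top p ∣ ℕ.≟ suc s) p∈ ∣top∣)))
      where
      ∣top∣ = ≡.trans (≡.sym (∣remove∣ (top p) (pivot p) (pivot∈ p))) (≡.cong suc ∣σ∣)

    cycles-bound : ∀ s a → IsDim (Cycle K s) a → a ℕ.+ D s ℕ.≤ List.length (spanning s)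
    cycles-bound s a ((zs , zs-cycles , zs-independent) , _) =
      independent⇒≤length (spanning s) (zs ++ (δ ∘ tops s)) (++-supported zs-supported tops-supported)
        (++-independent zs (δ ∘ tops s) zs-independent (λ i → proj₂ (zs-cycles i)) (∂δ-tops-independent s))
      where
      zs-supported : SupportedIn zs (spanning s)
      zs-supported i σ σ∉ = proj₁ (zs-cycles i) σ λ (σ-face , ∣σ∣) → σ∉ (face∈spanning σ-face ∣σ∣)
      tops-supported : SupportedIn (δ ∘ tops s) (spanning s)
      tops-supported j σ σ∉ = δ-other {σ = tops s j} {σ} λ where
        ≡.refl → σ∉ (∈-++⁺ʳ (bots-or-critical s) (∈-map⁺ top (∈-lookup j)))

    -- dim Z + D s ≤ |spanning s| = #critical + D (s + 1) + D s and D (s + 1) ≤ dim B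
    -- give dim Z ∸ dim B ≤ #critical.
    homology-bound : ∀ s h → HomDim K s h → h ℕ.≤ List.length (criticalOfSize s)
    homology-bound s h (a , b , cycles , boundaries , ≡.refl) =
      ℕₚ.m≤n+o⇒m∸n≤o a b (ℕₚ.≤-trans a≤c+D′ (ℕₚ.≤-trans (ℕₚ.+-monoʳ-≤ #crit D′≤b) (ℕₚ.≤-reflexive (ℕₚ.+-comm #crit b))))
      where
      #crit = List.length (criticalOfSize s)
      a≤c+D′ : a ℕ.≤ #crit ℕ.+ D (suc s)
      a≤c+D′ = ℕₚ.+-cancelʳ-≤ (D s) a _ (≡.subst (a ℕ.+ D s ℕ.≤_) (∣spanning∣ s) (cycles-bound s a cycles))
      D′≤b : D (suc s) ℕ.≤ b
      D′≤b = boundaries-bound s b boundaries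

    bettiBound : ∀ b → TotalBetti K b → b ℕ.≤ List.length (critical M)
    bettiBound b (hs , hom , ≡.refl) =
      ≡.subst₂ ℕ._≤_ (≡.sym (ℕSums.foldr-allFinL≡sum hs)) (count-by-size (critical M))
                     (sum-mono λ s → homology-bound (toℕ s) (hs s) (hom s))
      where module ℕSums = FinSums ℕₚ.+-0-commutativeMonoid

module ComplexClasses where

  open Subsets
  open MorseCovers
  open CriticalBounds
  open import Data.Nat as ℕ using (zero; suc; _+_)
  import Data.Nat.Properties as ℕₚ
  open import Data.Fin.Properties using (any?)
  open import Data.Vec using (lookup)
  open import Data.Vec.Properties using (lookup-replicate; []=⇒lookup)
  open import Data.Fin.Subset using (Subset; inside; ∣_∣; ⊤; _⊂_)
  open import Data.Fin.Subset.Properties using (∣⊤∣≡n)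
  import Data.Bool as Bool
  open import Data.Product using (Σ; _×_; _,_; proj₁)
  open import Data.Empty using (⊥-elim)
  open import Relation.Nullary using (¬_; Dec; yes; no; _×-dec_; ¬?)
  open import Relation.Nullary.Decidable using (decidable-stable)
  open import Relation.Binary.PropositionalEquality

  module _ {n} (K : SimplicialComplex n) (face? : ∀ σ → Dec (IsFace K σ)) where

    -- Drop vertices as long as a non-face remains; when every facet is a face, the set is minimal.
    minimalNonFace⊑ : ∀ k σ → ∣ σ ∣ ≡ k → ¬ IsFace K σ →
                      Σ (Subset n) λ ρ → ρ ⊑ σ × IsMinimalNonFace K ρ
    minimalNonFace⊑ zero σ ∣σ∣ σ∉ = σ , ⊑-refl , σ∉ , λ τ (_ , x , x∈σ , _) →
      ⊥-elim (in≢out (trans (sym ([]=⇒lookup x∈σ)) (∣∣≡0⇒outside σ ∣σ∣ x)))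
    minimalNonFace⊑ (suc k) σ ∣σ∣ σ∉
      with any? (λ u → (lookup σ u Bool.≟ inside) ×-dec ¬? (face? (remove σ u)))
    ... | yes (u , σu , σ∖u∉) with ρ , ρ⊑σ∖u , ρ-minimal ←
          minimalNonFace⊑ k (remove σ u) (ℕₚ.suc-injective (trans (∣remove∣ σ u σu) ∣σ∣)) σ∖u∉ =
      ρ , ⊑-trans ρ⊑σ∖u (remove⊑ σ u) , ρ-minimal
    ... | no no-nonface-facet = σ , ⊑-refl , σ∉ , proper-faces
      where
      proper-faces : ∀ τ → τ ⊂ σ → IsFace K τ
      proper-faces τ τ⊂σ with τ⊑σ , x , σx , τx ← ⊂⇒⊏ τ⊂σ =
        down-closed K (remove σ x) τ (⊑⇒⊆ (⊑remove x τ⊑σ τx))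
          (decidable-stable (face? (remove σ x)) λ σ∖x∉ → no-nonface-facet (x , σx , σ∖x∉))

    supportedOn-⊤ : SupportedOn (toDecComplex K face?) ⊤
    supportedOn-⊤ σ _ = ⊑-intro λ x _ → lookup-replicate x inside

    inF⇒smallNonFaces : ∀ {d} → InF K d → SmallNonFaces d (toDecComplex K face?) ⊤
    inF⇒smallNonFaces K∈F σ _ σ∉ with ρ , ρ⊑σ , ρ-minimal ← minimalNonFace⊑ ∣ σ ∣ σ refl σ∉ =
      ρ , ρ⊑σ , proj₁ ρ-minimal , K∈F ρ ρ-minimal

    inM⇒largeMaximalFaces : ∀ {d} → InM K d → LargeMaximalFaces d (toDecComplex K face?) ⊤
    inM⇒largeMaximalFaces {d} K∈M σ (σ-face , σ-maximal) = subst (ℕ._≤ ∣ σ ∣ + d) (sym (∣⊤∣≡n n))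
      (ℕₚ.≤-trans (ℕₚ.m≤n+m∸n n d) (ℕₚ.≤-trans (ℕₚ.+-monoʳ-≤ d (K∈M σ σ-maximal′))
                                                (ℕₚ.≤-reflexive (ℕₚ.+-comm d ∣ σ ∣))))
      where
      σ-maximal′ : IsMaximalFace K σ
      σ-maximal′ = σ-face , λ τ σ⊂τ → σ-maximal τ (⊂⇒⊏ σ⊂τ)

open MorseCovers using (toDecComplex)
open CriticalBounds using (CoverWithin; module Recursions)
open ComplexClasses
open GeometricSums using (ℕtoℚ-mono; geom≤pow)
open DoubleNegation using (¬¬-decidable-on-subsets)
open MorseInequality using (bettiBound)

coverWithinPow : ∀ {n d q} (K : SimplicialComplex n) (face? : ∀ σ → Dec (IsFace K σ)) →
                 1ℚ ℚ.≤ q → geomℚ q d ℚ.< powℚ q d → InF K d ⊎ InM K d →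
                 CoverWithin (toDecComplex K face?) (powℚ q n)
coverWithinPow {n} {d} {q} K face? 1≤q θ<q (inj₁ K∈F) =
  fBound n (toDecComplex K face?) ⊤ (∣⊤∣≡n n) (supportedOn-⊤ K face?) (inF⇒smallNonFaces K face? K∈F)
  where open Recursions q d 1≤q θ<q
coverWithinPow {n} {d} {q} K face? 1≤q θ<q (inj₂ K∈M) =
  mBound n (toDecComplex K face?) ⊤ (∣⊤∣≡n n) (supportedOn-⊤ K face?) (inM⇒largeMaximalFaces K face? K∈M)
  where open Recursions q d 1≤q θ<q

theorem5p2 : ∀ {c ℓ : Level} (𝕜 : Field c ℓ) (d : ℕ) → 1 ≤ d →
    ∀ (n : ℕ) (K : SimplicialComplex n) → InF K d ⊎ InM K d →
    ∀ (b : ℕ) → Homology.TotalBetti 𝕜 K b → BelowThetaPow d n b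
theorem5p2 𝕜 d 1≤d n K K∈F⊎M b betti q 0<q θ<q =
  decidable-stable (ℕtoℚ b ℚₚ.≤? powℚ q n) λ b≰qⁿ →
    ¬¬-decidable-on-subsets n (IsFace K) λ face? → b≰qⁿ (bound face?)
  where
  1≤q : 1ℚ ℚ.≤ q
  1≤q = subst₂ ℚ._≤_ (ℚₚ.+-identityʳ 1ℚ) (ℚₚ.*-identityʳ q) (geom≤pow q (ℚₚ.<⇒≤ 0<q) θ<q 1≤d)
  bound : (∀ σ → Dec (IsFace K σ)) → ℕtoℚ b ℚ.≤ powℚ q n
  bound face? with M , M≤qⁿ ← coverWithinPow K face? 1≤q θ<q K∈F⊎M =
    ℚₚ.≤-trans (ℕtoℚ-mono (bettiBound 𝕜 K face? M b betti)) M≤qⁿ
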